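{- Let $\mathbf{h}$ be a weakly increasing sequence of positive integers with $\mathbf{h}(i)>i$ for all $i$, let $S$ be a nonempty $\mathbf{h}$-admissible set and $m=\mathbf{m}(S)$. Then $$a_0(S)=b_{\mathbf{h}(m)}(S)\quad\text{and}\quad a_k(S)=\sum_{j=k}^{m}\binom{j-1}{k-1}b_{\mathbf{h}(m)-j}(S)\ \text{ for all } 1\le k\le m.$$
   Context: $\mathcal{P}_\mathbf{h}=\{(i,j): i<j\le \mathbf{h}(i)\}$. For $\pi\in S_n$, $\mathrm{inv}_\mathbf{h}(\pi)=\{(i,j)\in\mathcal{P}_\mathbf{h}: j\le n,\ \pi_i>\pi_j\}$. $S$ is $\mathbf{h}$-admissible if $S=\mathrm{inv}_\mathbf{h}(\pi)$ for some permutation $\pi$. $I_\mathbf{h}(S,n)=\{\pi\in S_n:\mathrm{inv}_\mathbf{h}(\pi)=S\}$. $\mathbf{m}(S)=\max\{i:(i,i+1)\in S\}$. For each $k$, $b_k(S)=\#\{\pi\in I_\mathbf{h}(S,\mathbf{h}(m)):\pi_{\mathbf{h}(m)}=k\}$. With $N=m+\mathbf{h}(m)-1$, $a_k(S)=\#\{\pi\in I_\mathbf{h}(S,N): \{\pi_1,\dots,\pi_m\}\cap[\mathbf{h}(m),N]=[\mathbf{h}(m),\mathbf{h}(m)+k-1]\}$ for $0\le k\le m$. -}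

module Defs where

open import Data.Bool using (Bool; true; false; _∧_; _∨_; not; T)
open import Data.Nat using (ℕ; zero; suc; _+_; _*_; _∸_; _≡ᵇ_; _<ᵇ_; _≤ᵇ_; _⊔_)
open import Data.Product using (_×_; _,_; Σ; proj₁; proj₂)
open import Data.List using (List; []; _∷_; map; concatMap; filterᵇ; length; all; any; applyUpTo; take; foldr)

interval : ℕ → ℕ → List ℕ
interval a b = applyUpTo (a +_) (suc b ∸ a)

elemᵇ : ℕ → List ℕ → Bool
elemᵇ v xs = any (v ≡ᵇ_) xs

-- Finite sets of pairs of positive integers, represented by lists (duplicates irrelevant).
Pair : Set
Pair = ℕ × ℕ

pairEqᵇ : Pair → Pair → Bool
pairEqᵇ (a , b) (c , d) = (a ≡ᵇ c) ∧ (b ≡ᵇ d)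

pairElemᵇ : Pair → List Pair → Bool
pairElemᵇ p xs = any (pairEqᵇ p) xs

sameSetᵇ : List Pair → List Pair → Bool
sameSetᵇ A B = all (λ p → pairElemᵇ p B) A ∧ all (λ p → pairElemᵇ p A) B

-- A permutation π ∈ S_n is the word π_1 π_2 ... π_n (a list).
-- π_i, 1-indexed (value 0 outside the range, never used).
at : List ℕ → ℕ → ℕ
at []       _             = 0
at (x ∷ xs) zero          = 0
at (x ∷ xs) (suc zero)    = x
at (x ∷ xs) (suc (suc i)) = at xs (suc i)

isPermᵇ : ℕ → List ℕ → Bool
isPermᵇ n π = (length π ≡ᵇ n) ∧ all (λ v → elemᵇ v π) (interval 1 n)

words : ℕ → ℕ → List (List ℕ)
words n zero    = [] ∷ []
words n (suc k) = concatMap (λ v → map (v ∷_) (words n k)) (interval 1 n)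

Sym : ℕ → List (List ℕ)
Sym n = filterᵇ (isPermᵇ n) (words n n)

inv : (ℕ → ℕ) → ℕ → List ℕ → List Pair
inv h n π =
  concatMap (λ i → map (i ,_)
    (filterᵇ (λ j → (j ≤ᵇ h i) ∧ (at π j <ᵇ at π i)) (interval (suc i) n)))
  (interval 1 n)

Admissible : (ℕ → ℕ) → List Pair → Set
Admissible h S = Σ ℕ λ n → Σ (List ℕ) λ π → T (isPermᵇ n π) × T (sameSetᵇ (inv h n π) S)

-- Number of elements of I_h(S,n) satisfying an extra boolean condition.
countI : (ℕ → ℕ) → List Pair → ℕ → (List ℕ → Bool) → ℕ
countI h S n P = length (filterᵇ (λ π → sameSetᵇ (inv h n π) S ∧ P π) (Sym n))

mS : List Pair → ℕ
mS S = foldr _⊔_ 0 (map proj₁ (filterᵇ (λ p → suc (proj₁ p) ≡ᵇ proj₂ p) S))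

b : (ℕ → ℕ) → List Pair → ℕ → ℕ
b h S k = countI h S (h (mS S)) (λ π → at π (h (mS S)) ≡ᵇ k)

-- a_k(S) = #{ π ∈ I_h(S, N) : {π_1..π_m} ∩ [h(m), N] = [h(m), h(m)+k-1] },  N = m + h(m) - 1.
a : (ℕ → ℕ) → List Pair → ℕ → ℕ
a h S k = countI h S N
    (λ π → all (λ v → eqB (elemᵇ v (take m π)) (v <ᵇ h m + k)) (interval (h m) N))
  where
    m = mS S
    N = m + h m ∸ 1
    eqB : Bool → Bool → Bool
    eqB x y = (x ∧ y) ∨ (not x ∧ not y)

{-# OPTIONS --safe #-}
-- Let M = h(m). Every pair of S lies in [1, M], and S contains no pair (l, l+1) with l > m, so beyond
-- place m every member of I_h(S, n) ascends. Hence, for n ≥ M, the members of I_h(S, n+1) are exactly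
-- the permutations obtained from some π ∈ I_h(S, n) by appending a value v > π_n and raising the
-- values ≥ v of π: a new inversion (i, n+1) would need i > m, where π stays below v.
-- Along this recursion a value above M + k - 1 can never enter the first m places, so N may be lowered
-- to M + k - 1 (to M if k = 0) without changing a_k. There a_k counts the permutations whose first m
-- entries contain [M, M + k - 1]; removing the last entry k - 1 times, each time by the hockey-stick
-- identity, leaves the sum over r of C(M-1-r, k-1) b_r, as r = π_M runs over I_h(S, M). Putting
-- r = M - j and using b_r = 0 for r < M - m gives the formula. For k = 0 one ends at n = M, where M
-- avoids the first m places exactly when π_M = M, which is b_M.
module Submission where

open import Defs
open import Data.Bool using (Bool; true; false; _∧_; _∨_; not; T; if_then_else_)
open import Data.Bool.Properties using (T-≡; T-∧; T-not-≡; ∧-assoc; ∧-identityʳ)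
open import Data.Empty using (⊥-elim)
open import Data.Nat using (ℕ; zero; suc; _+_; _*_; _∸_; _≡ᵇ_; _<ᵇ_; _≤ᵇ_; _⊔_; _≤_; _<_; z≤n; s≤s; z<s; s<s)
open import Data.Nat.Properties
open import Data.Nat.Combinatorics using (_C_; k>n⇒nCk≡0; nCk+nC[k+1]≡[n+1]C[k+1])
open import Data.Nat.ListAction.Properties using (sum-++)
open import Algebra.Properties.CommutativeSemigroup +-commutativeSemigroup using (interchange)
open import Data.Product using (_×_; _,_; ∃; proj₁; proj₂)
open import Data.Sum using (inj₁; inj₂)
open import Data.List using (List; []; _∷_; [_]; _++_; map; concatMap; filterᵇ; length; all; applyUpTo; take; foldr; sum; cartesianProductWith)
open import Data.List.Properties using (length-applyUpTo; take-map; map-++; map-∘; map-cong-local; map-id-local; length-map; length-++; ∷ʳ-injective; ∷ʳ-injectiveˡ; map-injective; ∷-injective)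
open import Data.List.Membership.Propositional using (_∈_; _∉_; find; lose)
open import Data.List.Membership.Propositional.Properties
  using (∈-∃++; ∈-++⁻; ∈-++⁺ˡ; ∈-++⁺ʳ; ∈-map⁺; ∈-map⁻; ∈-concatMap⁺; ∈-concatMap⁻; ∈-filter⁺; ∈-filter⁻;
         ∈-cartesianProductWith⁺; ∈-cartesianProductWith⁻)
open import Data.List.Membership.Propositional.Properties.WithK using (unique∧set⇒bag)
open import Data.List.Relation.Unary.All as All using (All; []; _∷_)
open import Data.List.Relation.Unary.All.Properties using (all⁺; all⁻)
open import Data.List.Relation.Unary.Any as Any using (here; there)
open import Data.List.Relation.Unary.Any.Properties using (any⁺; any⁻)
open import Data.List.Relation.Unary.AllPairs using ([]; _∷_)
open import Data.List.Relation.Unary.Unique.Propositional using (Unique)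
import Data.List.Relation.Unary.Unique.Propositional.Properties as Unique
open import Data.List.Relation.Binary.BagAndSetEquality using (∼bag⇒↭)
open import Data.List.Relation.Binary.Permutation.Propositional using (_↭_)
open import Data.List.Relation.Binary.Permutation.Propositional.Properties using (↭-length; filter-↭)
open import Data.List.Relation.Binary.Subset.Propositional using (_⊆_)
open import Data.List.Base using (initLast; _∷ʳ′_)
open import Function using (_∘_; Equivalence; mk⇔)
open import Relation.Binary.PropositionalEquality hiding ([_])
open import Relation.Nullary using (¬_; yes; no)
open import Relation.Nullary.Decidable using (dec-true; dec-false; T?)
open import Relation.Binary.Definitions using (tri<; tri≈; tri>)

χ : Bool → ℕ
χ true  = 1
χ false = 0

χ-∧ : ∀ x y → χ (x ∧ y) ≡ χ x * χ y
χ-∧ false y = refl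
χ-∧ true  y = sym (+-identityʳ (χ y))

T-ext : ∀ {x y} → (T x → T y) → (T y → T x) → x ≡ y
T-ext {false} {false} f g = refl
T-ext {false} {true}  f g = ⊥-elim (g _)
T-ext {true}  {false} f g = ⊥-elim (f _)
T-ext {true}  {true}  f g = refl

T⇒≡true : ∀ {x} → T x → x ≡ true
T⇒≡true = Equivalence.to T-≡

¬T⇒≡false : ∀ {x} → ¬ T x → x ≡ false
¬T⇒≡false {false} _  = refl
¬T⇒≡false {true}  ¬t = ⊥-elim (¬t _)

module _ {m n : ℕ} where
  <ᵇ-true : m < n → (m <ᵇ n) ≡ true
  <ᵇ-true = dec-true (m <? n)

  <ᵇ-false : n ≤ m → (m <ᵇ n) ≡ false
  <ᵇ-false = dec-false (m <? n) ∘ ≤⇒≯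

  ≤ᵇ-true : m ≤ n → (m ≤ᵇ n) ≡ true
  ≤ᵇ-true = dec-true (m ≤? n)

  ≤ᵇ-false : n < m → (m ≤ᵇ n) ≡ false
  ≤ᵇ-false = dec-false (m ≤? n) ∘ <⇒≱

  ≡ᵇ-true : m ≡ n → (m ≡ᵇ n) ≡ true
  ≡ᵇ-true = dec-true (m ≟ n)

  ≡ᵇ-false : m ≢ n → (m ≡ᵇ n) ≡ false
  ≡ᵇ-false = dec-false (m ≟ n)

all-++ : ∀ {A : Set} (p : A → Bool) xs ys → all p (xs ++ ys) ≡ all p xs ∧ all p ys
all-++ p []       ys = refl
all-++ p (x ∷ xs) ys = trans (cong (p x ∧_) (all-++ p xs ys)) (sym (∧-assoc (p x) _ _))

all-cong : ∀ {A : Set} {p q : A → Bool} xs → (∀ {x} → x ∈ xs → p x ≡ q x) → all p xs ≡ all q xs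
all-cong []       p≗q = refl
all-cong (x ∷ xs) p≗q = cong₂ _∧_ (p≗q (here refl)) (all-cong xs (p≗q ∘ there))

≢[]⇒∃∈ : ∀ {A : Set} {xs : List A} → xs ≢ [] → ∃ λ x → x ∈ xs
≢[]⇒∃∈ {xs = []}    xs≢[] = ⊥-elim (xs≢[] refl)
≢[]⇒∃∈ {xs = x ∷ _} _     = x , here refl

∈⇒≤foldr-⊔ : ∀ {x} xs → x ∈ xs → x ≤ foldr _⊔_ 0 xs
∈⇒≤foldr-⊔ (y ∷ xs) (here refl) = m≤m⊔n y (foldr _⊔_ 0 xs)
∈⇒≤foldr-⊔ (y ∷ xs) (there x∈) = m≤n⇒m≤o⊔n y (∈⇒≤foldr-⊔ xs x∈)

concatMap≡cartesianProductWith : ∀ {A B C : Set} (f : A → B → C) xs ys →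
  concatMap (λ x → map (f x) ys) xs ≡ cartesianProductWith f xs ys
concatMap≡cartesianProductWith f []       ys = refl
concatMap≡cartesianProductWith f (x ∷ xs) ys = cong (map (f x) ys ++_) (concatMap≡cartesianProductWith f xs ys)

take-++ˡ : ∀ {A : Set} k (xs ys : List A) → k ≤ length xs → take k (xs ++ ys) ≡ take k xs
take-++ˡ zero    xs       ys _         = refl
take-++ˡ (suc k) (x ∷ xs) ys (s≤s k≤) = cong (x ∷_) (take-++ˡ k xs ys k≤)

∈-take⇒∈ : ∀ {A : Set} {u : A} k xs → u ∈ take k xs → u ∈ xs
∈-take⇒∈ (suc k) (x ∷ xs) (here refl) = here refl
∈-take⇒∈ (suc k) (x ∷ xs) (there u∈)  = there (∈-take⇒∈ k xs u∈)

elemᵇ⁻ : ∀ {v} xs → T (elemᵇ v xs) → v ∈ xs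
elemᵇ⁻ {v} xs t = Any.map (≡ᵇ⇒≡ v _) (any⁻ (v ≡ᵇ_) xs t)

elemᵇ⁺ : ∀ {v} xs → v ∈ xs → T (elemᵇ v xs)
elemᵇ⁺ {v} xs v∈ = any⁺ (v ≡ᵇ_) (Any.map (≡⇒≡ᵇ v _) v∈)

Unique-∷ʳ⁻ : ∀ {A : Set} (xs : List A) v → Unique (xs ++ [ v ]) → Unique xs × v ∉ xs
Unique-∷ʳ⁻ []       v _           = [] , λ ()
Unique-∷ʳ⁻ (x ∷ xs) v (x∉ ∷ uxs) with Unique-∷ʳ⁻ xs v uxs
... | uxs′ , v∉xs = All.tabulate (λ y∈ → All.lookup x∉ (∈-++⁺ˡ y∈)) ∷ uxs′ , v∉x∷xs
  where
  v∉x∷xs : v ∉ x ∷ xs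
  v∉x∷xs (here refl) = All.lookup x∉ (∈-++⁺ʳ xs (here refl)) refl
  v∉x∷xs (there v∈)  = v∉xs v∈

Unique-insert : ∀ {A : Set} (as bs : List A) {y} → Unique (as ++ bs) → y ∉ as ++ bs → Unique (as ++ y ∷ bs)
Unique-insert []       bs u y∉ = All.tabulate (λ z∈ y≡z → y∉ (subst (_∈ bs) (sym y≡z) z∈)) ∷ u
Unique-insert (a ∷ as) bs (a∉ ∷ u) y∉ = All.tabulate a≢ ∷ Unique-insert as bs u (y∉ ∘ there)
  where
  a≢ : ∀ {z} → z ∈ as ++ _ ∷ bs → a ≢ z
  a≢ z∈ with ∈-++⁻ as z∈
  ... | inj₁ z∈as         = All.lookup a∉ (∈-++⁺ˡ z∈as)
  ... | inj₂ (here refl)  = λ a≡y → y∉ (here (sym a≡y))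
  ... | inj₂ (there z∈bs) = All.lookup a∉ (∈-++⁺ʳ as z∈bs)

pigeonhole : ∀ {A : Set} (ys xs : List A) → Unique ys → ys ⊆ xs → length xs ≤ length ys → Unique xs × xs ⊆ ys
pigeonhole []       []  _ _ _ = [] , λ ()
pigeonhole (y ∷ ys) xs (y∉ys ∷ uys) ys⊆xs len≤ with ∈-∃++ (ys⊆xs (here refl))
... | as , bs , refl = Unique-insert as bs (proj₁ ih) y∉as++bs , ⊆y∷ys
  where
  ys⊆as++bs : ys ⊆ as ++ bs
  ys⊆as++bs z∈ys with ∈-++⁻ as (ys⊆xs (there z∈ys))
  ... | inj₁ z∈as         = ∈-++⁺ˡ z∈as
  ... | inj₂ (here refl)  = ⊥-elim (All.lookup y∉ys z∈ys refl)
  ... | inj₂ (there z∈bs) = ∈-++⁺ʳ as z∈bs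
  shorter : length (as ++ bs) ≤ length ys
  shorter = ≤-pred (subst (_≤ suc (length ys)) (trans (length-++ as) (trans (+-suc _ _) (cong suc (sym (length-++ as))))) len≤)
  ih = pigeonhole ys (as ++ bs) uys ys⊆as++bs shorter
  y∉as++bs : y ∉ as ++ bs
  y∉as++bs y∈ = All.lookup y∉ys (proj₂ ih y∈) refl
  ⊆y∷ys : as ++ y ∷ bs ⊆ y ∷ ys
  ⊆y∷ys x∈ with ∈-++⁻ as x∈
  ... | inj₁ x∈as         = there (proj₂ ih (∈-++⁺ˡ x∈as))
  ... | inj₂ (here refl)  = here refl
  ... | inj₂ (there x∈bs) = there (proj₂ ih (∈-++⁺ʳ as x∈bs))

upFrom : ℕ → ℕ → List ℕ
upFrom a zero    = []
upFrom a (suc k) = a ∷ upFrom (suc a) k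

applyUpTo≡upFrom : ∀ (f : ℕ → ℕ) a k → (∀ i → f i ≡ a + i) → applyUpTo f k ≡ upFrom a k
applyUpTo≡upFrom f a zero    f≗ = refl
applyUpTo≡upFrom f a (suc k) f≗ =
  cong₂ _∷_ (trans (f≗ 0) (+-identityʳ a)) (applyUpTo≡upFrom (f ∘ suc) (suc a) k (λ i → trans (f≗ (suc i)) (+-suc a i)))

interval≡upFrom : ∀ a b → interval a b ≡ upFrom a (suc b ∸ a)
interval≡upFrom a b = applyUpTo≡upFrom (a +_) a (suc b ∸ a) (λ _ → refl)

∈-upFrom⁻ : ∀ {u} a k → u ∈ upFrom a k → a ≤ u × u < a + k
∈-upFrom⁻ a (suc k) (here refl) = ≤-refl , m<m+n a z<s
∈-upFrom⁻ {u} a (suc k) (there u∈) with ∈-upFrom⁻ (suc a) k u∈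
... | a<u , u<a+k = <⇒≤ a<u , subst (u <_) (sym (+-suc a k)) u<a+k

∈-upFrom⁺ : ∀ {u} a k → a ≤ u → u < a + k → u ∈ upFrom a k
∈-upFrom⁺ a zero    a≤u u<a+0 = ⊥-elim (<⇒≱ u<a+0 (subst (_≤ _) (sym (+-identityʳ a)) a≤u))
∈-upFrom⁺ {u} a (suc k) a≤u u<a+k with m≤n⇒m<n∨m≡n a≤u
... | inj₂ refl = here refl
... | inj₁ a<u  = there (∈-upFrom⁺ (suc a) k a<u (subst (u <_) (+-suc a k) u<a+k))

∈-interval⁻ : ∀ {u} a b → u ∈ interval a b → a ≤ u × u ≤ b
∈-interval⁻ {u} a b u∈ with ∈-upFrom⁻ a (suc b ∸ a) (subst (u ∈_) (interval≡upFrom a b) u∈) | a ≤? suc b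
... | a≤u , u<end | yes a≤b+1 = a≤u , ≤-pred (subst (u <_) (m+[n∸m]≡n a≤b+1) u<end)
... | a≤u , u<end | no  a≰b+1 =
  ⊥-elim (<⇒≱ (subst (u <_) (trans (cong (a +_) (m≤n⇒m∸n≡0 (<⇒≤ (≰⇒> a≰b+1)))) (+-identityʳ a)) u<end) a≤u)

∈-interval⁺ : ∀ {u} a b → a ≤ u → u ≤ b → u ∈ interval a b
∈-interval⁺ {u} a b a≤u u≤b = subst (u ∈_) (sym (interval≡upFrom a b))
  (∈-upFrom⁺ a (suc b ∸ a) a≤u (subst (u <_) (sym (m+[n∸m]≡n (≤-trans a≤u (m≤n⇒m≤1+n u≤b)))) (s≤s u≤b)))

module _ {p : ℕ → Bool} {a b : ℕ} where
  all-interval⁻ : T (all p (interval a b)) → ∀ {u} → a ≤ u → u ≤ b → T (p u)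
  all-interval⁻ t a≤u u≤b = All.lookup (all⁺ p (interval a b) t) (∈-interval⁺ a b a≤u u≤b)

  all-interval⁺ : (∀ {u} → a ≤ u → u ≤ b → T (p u)) → T (all p (interval a b))
  all-interval⁺ pu = all⁻ p (All.tabulate (λ u∈ → pu (proj₁ (∈-interval⁻ a b u∈)) (proj₂ (∈-interval⁻ a b u∈))))

upFrom-∷ʳ : ∀ a k → upFrom a (suc k) ≡ upFrom a k ++ [ a + k ]
upFrom-∷ʳ a zero    = cong [_] (sym (+-identityʳ a))
upFrom-∷ʳ a (suc k) = cong (a ∷_) (trans (upFrom-∷ʳ (suc a) k) (cong (λ z → upFrom (suc a) k ++ [ z ]) (sym (+-suc a k))))

upFrom-++ : ∀ a i j → upFrom a (i + j) ≡ upFrom a i ++ upFrom (a + i) j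
upFrom-++ a zero    j = cong (λ z → upFrom z j) (sym (+-identityʳ a))
upFrom-++ a (suc i) j = cong (a ∷_) (trans (upFrom-++ (suc a) i j) (cong (λ z → upFrom (suc a) i ++ upFrom z j) (sym (+-suc a i))))

interval-∷ʳ : ∀ a b → a ≤ suc b → interval a (suc b) ≡ interval a b ++ [ suc b ]
interval-∷ʳ a b a≤b+1 = begin
  interval a (suc b)                         ≡⟨ interval≡upFrom a (suc b) ⟩
  upFrom a (suc (suc b) ∸ a)                 ≡⟨ cong (upFrom a) (+-∸-assoc 1 a≤b+1) ⟩
  upFrom a (suc (suc b ∸ a))                 ≡⟨ upFrom-∷ʳ a (suc b ∸ a) ⟩
  upFrom a (suc b ∸ a) ++ [ a + (suc b ∸ a) ] ≡⟨ cong₂ (λ xs y → xs ++ [ y ]) (sym (interval≡upFrom a b)) (m+[n∸m]≡n a≤b+1) ⟩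
  interval a b ++ [ suc b ]                  ∎
  where open ≡-Reasoning

interval-++ : ∀ a x b → a ≤ suc x → x ≤ b → interval a b ≡ interval a x ++ interval (suc x) b
interval-++ a x b a≤x+1 x≤b = begin
  interval a b                                           ≡⟨ interval≡upFrom a b ⟩
  upFrom a (suc b ∸ a)                                   ≡⟨ cong (upFrom a) length-split ⟩
  upFrom a ((suc x ∸ a) + (b ∸ x))                       ≡⟨ upFrom-++ a (suc x ∸ a) (b ∸ x) ⟩
  upFrom a (suc x ∸ a) ++ upFrom (a + (suc x ∸ a)) (b ∸ x) ≡⟨ cong₂ (λ xs i → xs ++ upFrom i (b ∸ x)) (sym (interval≡upFrom a x)) (m+[n∸m]≡n a≤x+1) ⟩
  interval a x ++ upFrom (suc x) (b ∸ x)                 ≡⟨ cong (interval a x ++_) (sym (interval≡upFrom (suc x) b)) ⟩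
  interval a x ++ interval (suc x) b                     ∎
  where
  open ≡-Reasoning
  length-split : suc b ∸ a ≡ (suc x ∸ a) + (b ∸ x)
  length-split = begin
    suc b ∸ a                       ≡⟨ cong (λ z → suc z ∸ a) (sym (m+[n∸m]≡n x≤b)) ⟩
    suc x + (b ∸ x) ∸ a             ≡⟨ +-∸-comm (b ∸ x) a≤x+1 ⟩
    (suc x ∸ a) + (b ∸ x)           ∎

interval-singleton : ∀ a → interval a a ≡ [ a ]
interval-singleton a = trans (interval≡upFrom a a) (cong (upFrom a) (trans (+-∸-assoc 1 (≤-refl {a})) (cong suc (n∸n≡0 a))))

Unique-interval : ∀ a b → Unique (interval a b)
Unique-interval a b = Unique.applyUpTo⁺₁ (a +_) (suc b ∸ a) (λ i<j _ → <⇒≢ (+-monoʳ-< a i<j))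

length-interval-1 : ∀ n → length (interval 1 n) ≡ n
length-interval-1 n = length-applyUpTo suc n

-- Sums over lists and intervals

module _ {A : Set} where

  sum-map-cong : ∀ {f g : A → ℕ} xs → (∀ {x} → x ∈ xs → f x ≡ g x) → sum (map f xs) ≡ sum (map g xs)
  sum-map-cong xs f≗g = cong sum (map-cong-local (All.tabulate f≗g))

  sum-map-zero : ∀ {f : A → ℕ} xs → (∀ {x} → x ∈ xs → f x ≡ 0) → sum (map f xs) ≡ 0
  sum-map-zero []       f≗0 = refl
  sum-map-zero (x ∷ xs) f≗0 = cong₂ _+_ (f≗0 (here refl)) (sum-map-zero xs (f≗0 ∘ there))

  sum-map-*ˡ : ∀ c (f : A → ℕ) xs → sum (map (λ x → c * f x) xs) ≡ c * sum (map f xs)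
  sum-map-*ˡ c f []       = sym (*-zeroʳ c)
  sum-map-*ˡ c f (x ∷ xs) = trans (cong (c * f x +_) (sum-map-*ˡ c f xs)) (sym (*-distribˡ-+ c (f x) _))

  sum-map-+ : ∀ (f g : A → ℕ) xs → sum (map (λ x → f x + g x) xs) ≡ sum (map f xs) + sum (map g xs)
  sum-map-+ f g []       = refl
  sum-map-+ f g (x ∷ xs) = trans (cong (f x + g x +_) (sum-map-+ f g xs)) (interchange (f x) (g x) _ _)

sum-cartesianProductWith : ∀ {A B C : Set} (F : C → ℕ) (f : A → B → C) xs ys →
  sum (map F (cartesianProductWith f xs ys)) ≡ sum (map (λ x → sum (map (F ∘ f x) ys)) xs)
sum-cartesianProductWith F f []       ys = refl
sum-cartesianProductWith F f (x ∷ xs) ys = begin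
  sum (map F (map (f x) ys ++ cartesianProductWith f xs ys))           ≡⟨ cong sum (map-++ F (map (f x) ys) _) ⟩
  sum (map F (map (f x) ys) ++ map F (cartesianProductWith f xs ys))   ≡⟨ sum-++ (map F (map (f x) ys)) _ ⟩
  sum (map F (map (f x) ys)) + sum (map F (cartesianProductWith f xs ys)) ≡⟨ cong₂ _+_ (cong sum (sym (map-∘ ys))) (sum-cartesianProductWith F f xs ys) ⟩
  sum (map (F ∘ f x) ys) + sum (map (λ x → sum (map (F ∘ f x) ys)) xs) ∎
  where open ≡-Reasoning

length-filterᵇ : ∀ {A : Set} (P : A → Bool) xs → length (filterᵇ P xs) ≡ sum (map (χ ∘ P) xs)
length-filterᵇ P []       = refl
length-filterᵇ P (x ∷ xs) with P x
... | true  = cong suc (length-filterᵇ P xs)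
... | false = length-filterᵇ P xs

sum-upFrom-reflect : ∀ (φ : ℕ → ℕ) c K a b → a + b + K ≡ suc c →
  sum (map φ (upFrom a K)) ≡ sum (map (λ j → φ (c ∸ j)) (upFrom b K))
sum-upFrom-reflect φ c zero    a b _ = refl
sum-upFrom-reflect φ c (suc K) a b a+b+K+1≡c+1 = begin
  φ a + sum (map φ (upFrom (suc a) K))             ≡⟨ cong (φ a +_) (sum-upFrom-reflect φ c K (suc a) b (trans (sym (+-suc (a + b) K)) a+b+K+1≡c+1)) ⟩
  φ a + sum (map ψ (upFrom b K))                   ≡⟨ +-comm (φ a) _ ⟩
  sum (map ψ (upFrom b K)) + φ a                   ≡⟨ cong (λ z → sum (map ψ (upFrom b K)) + z) (sym (+-identityʳ (φ a))) ⟩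
  sum (map ψ (upFrom b K)) + (φ a + 0)             ≡⟨ cong (λ z → sum (map ψ (upFrom b K)) + (φ z + 0)) a≡c∸[b+K] ⟩
  sum (map ψ (upFrom b K)) + sum (map ψ [ b + K ]) ≡⟨ sym (sum-++ (map ψ (upFrom b K)) _) ⟩
  sum (map ψ (upFrom b K) ++ map ψ [ b + K ])      ≡⟨ cong sum (sym (map-++ ψ (upFrom b K) _)) ⟩
  sum (map ψ (upFrom b K ++ [ b + K ]))            ≡⟨ cong (sum ∘ map ψ) (sym (upFrom-∷ʳ b K)) ⟩
  sum (map ψ (upFrom b (suc K)))                   ∎
  where
  open ≡-Reasoning
  ψ : ℕ → ℕ
  ψ j = φ (c ∸ j)
  a+[b+K]≡c : a + (b + K) ≡ c
  a+[b+K]≡c = suc-injective (begin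
    suc (a + (b + K)) ≡⟨ cong suc (sym (+-assoc a b K)) ⟩
    suc (a + b + K)   ≡⟨ sym (+-suc (a + b) K) ⟩
    a + b + suc K     ≡⟨ a+b+K+1≡c+1 ⟩
    suc c             ∎)
  a≡c∸[b+K] : a ≡ c ∸ (b + K)
  a≡c∸[b+K] = trans (sym (m+n∸n≡m a (b + K))) (cong (_∸ (b + K)) a+[b+K]≡c)

sum-interval-reflect : ∀ (φ : ℕ → ℕ) c k → 1 ≤ k → k ≤ c →
  sum (map φ (interval 1 (c ∸ k))) ≡ sum (map (λ j → φ (c ∸ j)) (interval k (c ∸ 1)))
sum-interval-reflect φ c k 1≤k k≤c = begin
  sum (map φ (interval 1 (c ∸ k)))                         ≡⟨ cong (sum ∘ map φ) (interval≡upFrom 1 (c ∸ k)) ⟩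
  sum (map φ (upFrom 1 (c ∸ k)))                           ≡⟨ sum-upFrom-reflect φ c (c ∸ k) 1 k (cong suc (m+[n∸m]≡n k≤c)) ⟩
  sum (map (λ j → φ (c ∸ j)) (upFrom k (c ∸ k)))           ≡⟨ cong (λ l → sum (map (λ j → φ (c ∸ j)) (upFrom k (l ∸ k)))) c≡1+[c∸1] ⟩
  sum (map (λ j → φ (c ∸ j)) (upFrom k (suc (c ∸ 1) ∸ k))) ≡⟨ cong (sum ∘ map (λ j → φ (c ∸ j))) (sym (interval≡upFrom k (c ∸ 1))) ⟩
  sum (map (λ j → φ (c ∸ j)) (interval k (c ∸ 1)))         ∎
  where
  open ≡-Reasoning
  c≡1+[c∸1] : c ≡ suc (c ∸ 1)
  c≡1+[c∸1] = +-∸-assoc 1 (≤-trans 1≤k k≤c)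

sum-χ-≡ᵇ : ∀ (f : ℕ → ℕ) x t → 1 ≤ x → sum (map (λ r → χ (x ≡ᵇ r) * f r) (interval 1 t)) ≡ χ (x ≤ᵇ t) * f x
sum-χ-≡ᵇ f x zero    1≤x = cong (λ b → χ b * f x) (sym (≤ᵇ-false 1≤x))
sum-χ-≡ᵇ f x (suc t) 1≤x = begin
  sum (map term (interval 1 (suc t)))                 ≡⟨ cong (sum ∘ map term) (interval-∷ʳ 1 t (s≤s z≤n)) ⟩
  sum (map term (interval 1 t ++ [ suc t ]))          ≡⟨ cong sum (map-++ term (interval 1 t) _) ⟩
  sum (map term (interval 1 t) ++ [ term (suc t) ])   ≡⟨ sum-++ (map term (interval 1 t)) _ ⟩
  sum (map term (interval 1 t)) + (term (suc t) + 0) ≡⟨ cong₂ _+_ (sum-χ-≡ᵇ f x t 1≤x) (+-identityʳ (term (suc t))) ⟩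
  χ (x ≤ᵇ t) * f x + term (suc t)                     ≡⟨ last-step ⟩
  χ (x ≤ᵇ suc t) * f x                                ∎
  where
  open ≡-Reasoning
  term : ℕ → ℕ
  term r = χ (x ≡ᵇ r) * f r
  last-step : χ (x ≤ᵇ t) * f x + term (suc t) ≡ χ (x ≤ᵇ suc t) * f x
  last-step with <-cmp x (suc t)
  ... | tri< x<t+1 x≢t+1 _ rewrite ≤ᵇ-true (≤-pred x<t+1) | ≡ᵇ-false x≢t+1 | ≤ᵇ-true (<⇒≤ x<t+1) = +-identityʳ _
  ... | tri≈ _ refl _       rewrite ≤ᵇ-false (n<1+n t) | ≡ᵇ-true (refl {x = x}) | ≤ᵇ-true (≤-refl {x}) = refl
  ... | tri> _ x≢t+1 t+1<x  rewrite ≤ᵇ-false (<-trans (n<1+n t) t+1<x) | ≡ᵇ-false x≢t+1 | ≤ᵇ-false t+1<x = refl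

sum-χ-<ᵇ : ∀ (F : ℕ → ℕ) x b → x ≤ b →
  sum (map (λ v → χ (x <ᵇ v) * F v) (interval 1 b)) ≡ sum (map F (interval (suc x) b))
sum-χ-<ᵇ F x b x≤b = begin
  sum (map term (interval 1 b))                                         ≡⟨ cong (sum ∘ map term) (interval-++ 1 x b (s≤s z≤n) x≤b) ⟩
  sum (map term (interval 1 x ++ interval (suc x) b))                   ≡⟨ cong sum (map-++ term (interval 1 x) _) ⟩
  sum (map term (interval 1 x) ++ map term (interval (suc x) b))        ≡⟨ sum-++ (map term (interval 1 x)) _ ⟩
  sum (map term (interval 1 x)) + sum (map term (interval (suc x) b))   ≡⟨ cong₂ _+_ (sum-map-zero (interval 1 x) below) (sum-map-cong (interval (suc x) b) above) ⟩
  sum (map F (interval (suc x) b))                                      ∎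
  where
  open ≡-Reasoning
  term : ℕ → ℕ
  term v = χ (x <ᵇ v) * F v
  below : ∀ {v} → v ∈ interval 1 x → term v ≡ 0
  below v∈ rewrite <ᵇ-false (proj₂ (∈-interval⁻ 1 x v∈)) = refl
  above : ∀ {v} → v ∈ interval (suc x) b → term v ≡ F v
  above v∈ rewrite <ᵇ-true (proj₁ (∈-interval⁻ (suc x) b v∈)) = +-identityʳ _

-- The indicator only matters when s = 0: for v > t the term (t + s ∸ v) C s vanishes unless s = 0.
hockey-stick : ∀ s t a b → t ≤ b →
  sum (map (λ v → χ (v ≤ᵇ t) * ((t + s ∸ v) C s)) (interval a b)) ≡ (suc (t + s) ∸ a) C (suc s)
hockey-stick s t a b t≤b =
  trans (cong (sum ∘ map term) (interval≡upFrom a b)) (go (suc b ∸ a) a (<-≤-trans (s≤s t≤b) (m≤n+m∸n (suc b) a)))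
  where
  term : ℕ → ℕ
  term v = χ (v ≤ᵇ t) * ((t + s ∸ v) C s)
  short : ∀ {a} → t < a → suc (t + s) ∸ a ≤ s
  short {a} t<a = ≤-trans (∸-monoʳ-≤ (suc (t + s)) t<a) (≤-reflexive (m+n∸m≡n t s))
  go : ∀ K a → t < a + K → sum (map term (upFrom a K)) ≡ (suc (t + s) ∸ a) C (suc s)
  go zero    a t<a+0 = sym (k>n⇒nCk≡0 (s≤s (short (subst (t <_) (+-identityʳ a) t<a+0))))
  go (suc K) a t<a+K+1 with go K (suc a) (subst (t <_) (+-suc a K) t<a+K+1) | a ≤? t
  ... | ih | yes a≤t = begin
    term a + sum (map term (upFrom (suc a) K))  ≡⟨ cong₂ (λ b z → χ b * ((t + s ∸ a) C s) + z) (≤ᵇ-true a≤t) ih ⟩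
    1 * ((t + s ∸ a) C s) + (t + s ∸ a) C (suc s) ≡⟨ cong (_+ (t + s ∸ a) C (suc s)) (*-identityˡ _) ⟩
    (t + s ∸ a) C s + (t + s ∸ a) C (suc s)     ≡⟨ nCk+nC[k+1]≡[n+1]C[k+1] (t + s ∸ a) s ⟩
    suc (t + s ∸ a) C (suc s)                   ≡⟨ cong (_C suc s) (sym (+-∸-assoc 1 (≤-trans a≤t (m≤m+n t s)))) ⟩
    (suc (t + s) ∸ a) C (suc s)                 ∎
    where open ≡-Reasoning
  ... | ih | no a≰t = trans (cong (λ b → χ b * ((t + s ∸ a) C s) + sum (map term (upFrom (suc a) K))) (≤ᵇ-false (≰⇒> a≰t))) (trans ih (trans
    (k>n⇒nCk≡0 (s≤s (≤-trans (∸-monoˡ-≤ a (n≤1+n (t + s))) (short (≰⇒> a≰t)))))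
    (sym (k>n⇒nCk≡0 (s≤s (short (≰⇒> a≰t)))))))

at-++ˡ : ∀ xs ys p → 1 ≤ p → p ≤ length xs → at (xs ++ ys) p ≡ at xs p
at-++ˡ (x ∷ xs) ys (suc zero)    _ _         = refl
at-++ˡ (x ∷ xs) ys (suc (suc p)) _ (s≤s p≤) = at-++ˡ xs ys (suc p) (s≤s z≤n) p≤

at-∷ʳ-last : ∀ xs v → at (xs ++ [ v ]) (suc (length xs)) ≡ v
at-∷ʳ-last []           v = refl
at-∷ʳ-last (x ∷ [])     v = refl
at-∷ʳ-last (x ∷ y ∷ xs) v = at-∷ʳ-last (y ∷ xs) v

at-map : ∀ (f : ℕ → ℕ) xs p → 1 ≤ p → p ≤ length xs → at (map f xs) p ≡ f (at xs p)
at-map f (x ∷ xs) (suc zero)    _ _         = refl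
at-map f (x ∷ xs) (suc (suc p)) _ (s≤s p≤) = at-map f xs (suc p) (s≤s z≤n) p≤

at-∈ : ∀ xs p → 1 ≤ p → p ≤ length xs → at xs p ∈ xs
at-∈ (x ∷ xs) (suc zero)    _ _         = here refl
at-∈ (x ∷ xs) (suc (suc p)) _ (s≤s p≤) = there (at-∈ xs (suc p) (s≤s z≤n) p≤)

∈⇒at : ∀ {x} xs → x ∈ xs → ∃ λ p → 1 ≤ p × p ≤ length xs × at xs p ≡ x
∈⇒at (y ∷ xs) (here refl) = 1 , s≤s z≤n , s≤s z≤n , refl
∈⇒at (y ∷ xs) (there x∈) with ∈⇒at xs x∈
... | suc p , _ , p≤ , eq = suc (suc p) , s≤s z≤n , s≤s p≤ , eq

at-injective : ∀ xs p q → Unique xs → 1 ≤ p → p ≤ length xs → 1 ≤ q → q ≤ length xs → at xs p ≡ at xs q → p ≡ q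
at-injective (x ∷ xs) (suc zero)    (suc zero)    _          _ _ _ _ _ = refl
at-injective (x ∷ xs) (suc zero)    (suc (suc q)) (x∉ ∷ _)   _ _ _ (s≤s q≤) eq =
  ⊥-elim (All.lookup x∉ (at-∈ xs (suc q) (s≤s z≤n) q≤) eq)
at-injective (x ∷ xs) (suc (suc p)) (suc zero)    (x∉ ∷ _)   _ (s≤s p≤) _ _ eq =
  ⊥-elim (All.lookup x∉ (at-∈ xs (suc p) (s≤s z≤n) p≤) (sym eq))
at-injective (x ∷ xs) (suc (suc p)) (suc (suc q)) (_ ∷ uxs) _ (s≤s p≤) _ (s≤s q≤) eq =
  cong suc (at-injective xs (suc p) (suc q) uxs (s≤s z≤n) p≤ (s≤s z≤n) q≤ eq)

∈-take⁻ : ∀ {u} k xs → u ∈ take k xs → ∃ λ p → 1 ≤ p × p ≤ k × p ≤ length xs × at xs p ≡ u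
∈-take⁻ (suc k) (x ∷ xs) (here refl) = 1 , s≤s z≤n , s≤s z≤n , s≤s z≤n , refl
∈-take⁻ (suc k) (x ∷ xs) (there u∈) with ∈-take⁻ k xs u∈
... | suc p , _ , p≤k , p≤ , eq = suc (suc p) , s≤s z≤n , s≤s p≤k , s≤s p≤ , eq

∈-take⁺ : ∀ k xs p → 1 ≤ p → p ≤ k → p ≤ length xs → at xs p ∈ take k xs
∈-take⁺ (suc k) (x ∷ xs) (suc zero)    _ _          _         = here refl
∈-take⁺ (suc k) (x ∷ xs) (suc (suc p)) _ (s≤s p≤k) (s≤s p≤) = there (∈-take⁺ k xs (suc p) (s≤s z≤n) p≤k p≤)

-- Permutations as iterated extensions

shift : ℕ → ℕ → ℕ
shift v x = if x <ᵇ v then x else suc x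

extend : List ℕ → ℕ → List ℕ
extend π v = map (shift v) π ++ [ v ]

perms : ℕ → List (List ℕ)
perms zero    = [ [] ]
perms (suc n) = cartesianProductWith extend (perms n) (interval 1 (suc n))

module _ {v x : ℕ} where
  shift-< : x < v → shift v x ≡ x
  shift-< x<v rewrite <ᵇ-true x<v = refl

  shift-≥ : v ≤ x → shift v x ≡ suc x
  shift-≥ v≤x rewrite <ᵇ-false v≤x = refl

  shift-≢ : shift v x ≢ v
  shift-≢ with x <? v
  ... | yes x<v = <⇒≢ (subst (_< v) (sym (shift-< x<v)) x<v)
  ... | no  x≮v = ≢-sym (<⇒≢ (subst (v <_) (sym (shift-≥ (≮⇒≥ x≮v))) (s≤s (≮⇒≥ x≮v))))

  v<shift⇒v≤ : v < shift v x → v ≤ x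
  v<shift⇒v≤ v<sx with x <? v
  ... | yes x<v = ⊥-elim (<-asym x<v (subst (v <_) (shift-< x<v) v<sx))
  ... | no  x≮v = ≮⇒≥ x≮v

  v≤⇒v<shift : v ≤ x → v < shift v x
  v≤⇒v<shift v≤x = subst (v <_) (sym (shift-≥ v≤x)) (s≤s v≤x)

shift-mono-< : ∀ v {x y} → x < y → shift v x < shift v y
shift-mono-< v {x} {y} x<y with x <? v | y <? v
... | yes x<v | yes y<v rewrite shift-< x<v | shift-< y<v = x<y
... | yes x<v | no  y≮v rewrite shift-< x<v | shift-≥ (≮⇒≥ y≮v) = m<n⇒m<1+n x<y
... | no  x≮v | yes y<v = ⊥-elim (x≮v (<-trans x<y y<v))
... | no  x≮v | no  y≮v rewrite shift-≥ (≮⇒≥ x≮v) | shift-≥ (≮⇒≥ y≮v) = s<s x<y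

shift-mono-≤ : ∀ v {x y} → x ≤ y → shift v x ≤ shift v y
shift-mono-≤ v x≤y with m≤n⇒m<n∨m≡n x≤y
... | inj₁ x<y  = <⇒≤ (shift-mono-< v x<y)
... | inj₂ refl = ≤-refl

shift-injective : ∀ v {x y} → shift v x ≡ shift v y → x ≡ y
shift-injective v {x} {y} eq with <-cmp x y
... | tri< x<y _ _ = ⊥-elim (<⇒≢ (shift-mono-< v x<y) eq)
... | tri≈ _ x≡y _ = x≡y
... | tri> _ _ y<x = ⊥-elim (<⇒≢ (shift-mono-< v y<x) (sym eq))

shift-cancel-< : ∀ v {x y} → shift v x < shift v y → x < y
shift-cancel-< v sx<sy = ≰⇒> (λ y≤x → <⇒≱ sx<sy (shift-mono-≤ v y≤x))

unshift : ℕ → ℕ → ℕ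
unshift v x = if x <ᵇ v then x else x ∸ 1

module _ {v x : ℕ} where
  unshift-< : x < v → unshift v x ≡ x
  unshift-< x<v rewrite <ᵇ-true x<v = refl

  unshift-suc : v ≤ x → unshift v (suc x) ≡ x
  unshift-suc v≤x rewrite <ᵇ-false (m≤n⇒m≤1+n v≤x) = refl

shift-unshift : ∀ v {x} → x ≢ v → shift v (unshift v x) ≡ x
shift-unshift v {x} x≢v with <-cmp x v
... | tri< x<v _ _ rewrite unshift-< x<v = shift-< x<v
... | tri≈ _ x≡v _ = ⊥-elim (x≢v x≡v)
shift-unshift v {suc x} x≢v | tri> _ _ v<x rewrite unshift-suc (≤-pred v<x) = shift-≥ (≤-pred v<x)

record IsPerm (n : ℕ) (π : List ℕ) : Set where
  field
    length≡  : length π ≡ n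
    unique   : Unique π
    bounded  : ∀ {x} → x ∈ π → 1 ≤ x × x ≤ n
    complete : ∀ {u} → 1 ≤ u → u ≤ n → u ∈ π

  at-bounded : ∀ {p} → 1 ≤ p → p ≤ n → 1 ≤ at π p × at π p ≤ n
  at-bounded {p} 1≤p p≤n = bounded (at-∈ π p 1≤p (subst (p ≤_) (sym length≡) p≤n))

length-extend : ∀ π v → length (extend π v) ≡ suc (length π)
length-extend π v = trans (length-++ (map (shift v) π)) (trans (+-comm _ 1) (cong suc (length-map (shift v) π)))

at-extend : ∀ π v {i} → 1 ≤ i → i ≤ length π → at (extend π v) i ≡ shift v (at π i)
at-extend π v {i} 1≤i i≤ = trans (at-++ˡ (map (shift v) π) [ v ] i 1≤i (subst (i ≤_) (sym (length-map (shift v) π)) i≤))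
                                 (at-map (shift v) π i 1≤i i≤)

at-extend-last : ∀ π v → at (extend π v) (suc (length π)) ≡ v
at-extend-last π v = subst (λ k → at (extend π v) (suc k) ≡ v) (length-map (shift v) π) (at-∷ʳ-last (map (shift v) π) v)

IsPerm-extend : ∀ {n π v} → IsPerm n π → 1 ≤ v → v ≤ suc n → IsPerm (suc n) (extend π v)
IsPerm-extend {n} {π} {v} p 1≤v v≤n+1 = record
  { length≡  = trans (length-extend π v) (cong suc length≡)
  ; unique   = Unique.++⁺ (Unique.map⁺ (shift-injective v) unique) ([] ∷ [])
                 (λ { (sx∈ , here refl) → let _ , _ , eq = ∈-map⁻ (shift v) sx∈ in shift-≢ (sym eq) })
  ; bounded  = bounded′
  ; complete = complete′
  }
  where
  open IsPerm p
  bounded′ : ∀ {x} → x ∈ extend π v → 1 ≤ x × x ≤ suc n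
  bounded′ x∈ with ∈-++⁻ (map (shift v) π) x∈
  ... | inj₂ (here refl) = 1≤v , v≤n+1
  ... | inj₁ sx∈ with ∈-map⁻ (shift v) sx∈
  ... | y , y∈ , refl with bounded y∈ | y <? v
  ... | 1≤y , y≤n | yes y<v rewrite shift-< y<v        = 1≤y , m≤n⇒m≤1+n y≤n
  ... | 1≤y , y≤n | no  y≮v rewrite shift-≥ (≮⇒≥ y≮v) = s≤s z≤n , s≤s y≤n
  complete′ : ∀ {u} → 1 ≤ u → u ≤ suc n → u ∈ extend π v
  complete′ {u} 1≤u u≤n+1 with <-cmp u v
  ... | tri≈ _ refl _ = ∈-++⁺ʳ (map (shift v) π) (here refl)
  ... | tri< u<v _ _  = ∈-++⁺ˡ (subst (_∈ map (shift v) π) (shift-< u<v) (∈-map⁺ (shift v) (complete 1≤u (≤-pred (≤-trans u<v v≤n+1)))))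
  complete′ {suc u} _ u≤n+1 | tri> _ _ v<u =
    ∈-++⁺ˡ (subst (_∈ map (shift v) π) (shift-≥ (≤-pred v<u)) (∈-map⁺ (shift v) (complete (≤-trans 1≤v (≤-pred v<u)) (≤-pred u≤n+1))))

extend-top : ∀ {n π} → IsPerm n π → extend π (suc n) ≡ π ++ [ suc n ]
extend-top p = cong (_++ _) (map-id-local (All.tabulate (λ x∈ → shift-< (s≤s (proj₂ (IsPerm.bounded p x∈))))))

perms⇒IsPerm : ∀ n {π} → π ∈ perms n → IsPerm n π
perms⇒IsPerm zero (here refl) = record
  { length≡ = refl ; unique = [] ; bounded = λ () ; complete = λ 1≤u u≤0 → ⊥-elim (<⇒≱ 1≤u u≤0) }
perms⇒IsPerm (suc n) π∈ with ∈-cartesianProductWith⁻ extend (perms n) (interval 1 (suc n)) π∈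
... | π′ , v , π′∈ , v∈ , refl with ∈-interval⁻ 1 (suc n) v∈
... | 1≤v , v≤n+1 = IsPerm-extend (perms⇒IsPerm n π′∈) 1≤v v≤n+1

extend-unshift : ∀ xs v → v ∉ xs → extend (map (unshift v) xs) v ≡ xs ++ [ v ]
extend-unshift xs v v∉xs = cong (_++ [ v ])
  (trans (sym (map-∘ xs)) (map-id-local (All.tabulate (λ x∈ → shift-unshift v (λ { refl → v∉xs x∈ })))))

IsPerm-unextend : ∀ {n} xs v → IsPerm (suc n) (xs ++ [ v ]) → IsPerm n (map (unshift v) xs)
IsPerm-unextend {n} xs v p = record
  { length≡  = trans (length-map (unshift v) xs) (suc-injective (trans (trans (+-comm 1 _) (sym (length-++ xs))) length≡))
  ; unique   = Unique.map⁻ (subst Unique (sym (∷ʳ-injectiveˡ _ _ (extend-unshift xs v v∉xs))) uxs)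
  ; bounded  = bounded′
  ; complete = complete′
  }
  where
  open IsPerm p
  uxs = proj₁ (Unique-∷ʳ⁻ xs v unique)
  v∉xs = proj₂ (Unique-∷ʳ⁻ xs v unique)
  1≤v = proj₁ (bounded (∈-++⁺ʳ xs (here refl)))
  v≤n+1 = proj₂ (bounded (∈-++⁺ʳ xs (here refl)))
  ∈xs : ∀ {u} → u ∈ xs ++ [ v ] → u ≢ v → u ∈ xs
  ∈xs u∈ u≢v with ∈-++⁻ xs u∈
  ... | inj₁ u∈xs = u∈xs
  ... | inj₂ (here u≡v) = ⊥-elim (u≢v u≡v)
  bounded′ : ∀ {y} → y ∈ map (unshift v) xs → 1 ≤ y × y ≤ n
  bounded′ y∈ with ∈-map⁻ (unshift v) y∈
  ... | x , x∈ , refl with bounded (∈-++⁺ˡ x∈) | <-cmp x v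
  ... | 1≤x , x≤n+1 | tri< x<v _ _ rewrite unshift-< x<v = 1≤x , ≤-pred (≤-trans x<v v≤n+1)
  ... | _ | tri≈ _ refl _ = ⊥-elim (v∉xs x∈)
  bounded′ y∈ | suc x , x∈ , refl | _ , x≤n+1 | tri> _ _ v<x rewrite unshift-suc (≤-pred v<x) =
    ≤-trans 1≤v (≤-pred v<x) , ≤-pred x≤n+1
  complete′ : ∀ {u} → 1 ≤ u → u ≤ n → u ∈ map (unshift v) xs
  complete′ {u} 1≤u u≤n with u <? v
  ... | yes u<v = subst (_∈ _) (unshift-< u<v) (∈-map⁺ (unshift v) (∈xs (complete 1≤u (m≤n⇒m≤1+n u≤n)) (<⇒≢ u<v)))
  ... | no  u≮v = subst (_∈ _) (unshift-suc (≮⇒≥ u≮v))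
                    (∈-map⁺ (unshift v) (∈xs (complete (s≤s z≤n) (s≤s u≤n)) (≢-sym (<⇒≢ (s≤s (≮⇒≥ u≮v))))))

IsPerm⇒∈perms : ∀ n {π} → IsPerm n π → π ∈ perms n
IsPerm⇒∈perms zero    {[]} _ = here refl
IsPerm⇒∈perms (suc n) {π} p with initLast π | IsPerm.length≡ p
... | []       | ()
... | xs ∷ʳ′ v | _ = subst (_∈ perms (suc n)) (extend-unshift xs v v∉xs)
  (∈-cartesianProductWith⁺ extend (IsPerm⇒∈perms n (IsPerm-unextend xs v p)) (∈-interval⁺ 1 (suc n) 1≤v v≤n+1))
  where
  open IsPerm p
  v∉xs = proj₂ (Unique-∷ʳ⁻ xs v unique)
  1≤v = proj₁ (bounded (∈-++⁺ʳ xs (here refl)))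
  v≤n+1 = proj₂ (bounded (∈-++⁺ʳ xs (here refl)))

extend-injective : ∀ {π π′ v v′} → extend π v ≡ extend π′ v′ → π ≡ π′ × v ≡ v′
extend-injective {π} {π′} {v} eq with ∷ʳ-injective (map (shift v) π) _ eq
... | shifted≡ , refl = map-injective (shift-injective v) shifted≡ , refl

Unique-perms : ∀ n → Unique (perms n)
Unique-perms zero    = [] ∷ []
Unique-perms (suc n) = Unique.cartesianProductWith⁺ extend extend-injective (Unique-perms n) (Unique-interval 1 (suc n))

words-suc : ∀ n k → words n (suc k) ≡ cartesianProductWith _∷_ (interval 1 n) (words n k)
words-suc n k = concatMap≡cartesianProductWith _∷_ (interval 1 n) (words n k)

∈-words⁻ : ∀ n k {w} → w ∈ words n k → length w ≡ k × (∀ {x} → x ∈ w → 1 ≤ x × x ≤ n)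
∈-words⁻ n zero    (here refl) = refl , λ ()
∈-words⁻ n (suc k) w∈ with ∈-cartesianProductWith⁻ _∷_ (interval 1 n) (words n k) (subst (_ ∈_) (words-suc n k) w∈)
... | x , w , x∈ , w∈′ , refl with ∈-words⁻ n k w∈′
... | len , bnd = cong suc len , λ { (here refl) → ∈-interval⁻ 1 n x∈ ; (there y∈) → bnd y∈ }

∈-words⁺ : ∀ n k {w} → length w ≡ k → (∀ {x} → x ∈ w → 1 ≤ x × x ≤ n) → w ∈ words n k
∈-words⁺ n zero    {[]}    _   _   = here refl
∈-words⁺ n (suc k) {x ∷ w} len bnd = subst (_ ∈_) (sym (words-suc n k))
  (∈-cartesianProductWith⁺ _∷_ (∈-interval⁺ 1 n (proj₁ (bnd (here refl))) (proj₂ (bnd (here refl))))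
                               (∈-words⁺ n k (suc-injective len) (bnd ∘ there)))

Unique-words : ∀ n k → Unique (words n k)
Unique-words n zero    = [] ∷ []
Unique-words n (suc k) = subst Unique (sym (words-suc n k))
  (Unique.cartesianProductWith⁺ _∷_ ∷-injective (Unique-interval 1 n) (Unique-words n k))

isPermᵇ⁻ : ∀ n π → T (isPermᵇ n π) → length π ≡ n × (∀ {u} → 1 ≤ u → u ≤ n → u ∈ π)
isPermᵇ⁻ n π t with Equivalence.to T-∧ t
... | len , cmp = ≡ᵇ⇒≡ _ _ len , λ 1≤u u≤n → elemᵇ⁻ π (All.lookup (all⁺ _ (interval 1 n) cmp) (∈-interval⁺ 1 n 1≤u u≤n))

isPermᵇ⁺ : ∀ n π → length π ≡ n → (∀ {u} → 1 ≤ u → u ≤ n → u ∈ π) → T (isPermᵇ n π)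
isPermᵇ⁺ n π len cmp = Equivalence.from T-∧ (≡⇒≡ᵇ _ _ len ,
  all⁻ _ (All.tabulate (λ u∈ → elemᵇ⁺ π (cmp (proj₁ (∈-interval⁻ 1 n u∈)) (proj₂ (∈-interval⁻ 1 n u∈))))))

Sym⇒IsPerm : ∀ n {π} → π ∈ Sym n → IsPerm n π
Sym⇒IsPerm n {π} π∈ with ∈-filter⁻ (T? ∘ isPermᵇ n) {xs = words n n} π∈
... | π∈words , t with ∈-words⁻ n n π∈words | isPermᵇ⁻ n π t
... | len , bnd | _ , cmp = record
  { length≡  = len
  ; unique   = proj₁ (pigeonhole (interval 1 n) π (Unique-interval 1 n)
                        (λ u∈ → cmp (proj₁ (∈-interval⁻ 1 n u∈)) (proj₂ (∈-interval⁻ 1 n u∈)))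
                        (≤-reflexive (trans len (sym (length-interval-1 n)))))
  ; bounded  = bnd
  ; complete = cmp
  }

IsPerm⇒∈Sym : ∀ n {π} → IsPerm n π → π ∈ Sym n
IsPerm⇒∈Sym n {π} p = ∈-filter⁺ (T? ∘ isPermᵇ n) (∈-words⁺ n n length≡ bounded) (isPermᵇ⁺ n π length≡ complete)
  where open IsPerm p

Unique-Sym : ∀ n → Unique (Sym n)
Unique-Sym n = Unique.filter⁺ (T? ∘ isPermᵇ n) (Unique-words n n)

Sym↭perms : ∀ n → Sym n ↭ perms n
Sym↭perms n = ∼bag⇒↭ (unique∧set⇒bag (Unique-Sym n) (Unique-perms n)
  (mk⇔ (IsPerm⇒∈perms n ∘ Sym⇒IsPerm n) (IsPerm⇒∈Sym n ∘ perms⇒IsPerm n)))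

count-Sym : ∀ n (P : List ℕ → Bool) → length (filterᵇ P (Sym n)) ≡ sum (map (χ ∘ P) (perms n))
count-Sym n P = trans (↭-length (filter-↭ (T? ∘ P) (Sym↭perms n))) (length-filterᵇ P (perms n))

-- Inversion sets

pairElemᵇ⁻ : ∀ {p} xs → T (pairElemᵇ p xs) → p ∈ xs
pairElemᵇ⁻ {a , b} xs t = Any.map same (any⁻ (pairEqᵇ (a , b)) xs t)
  where
  same : ∀ {q} → T (pairEqᵇ (a , b) q) → (a , b) ≡ q
  same {c , d} t with Equivalence.to T-∧ t
  ... | a≡c , b≡d = cong₂ _,_ (≡ᵇ⇒≡ a c a≡c) (≡ᵇ⇒≡ b d b≡d)

pairElemᵇ⁺ : ∀ {p} xs → p ∈ xs → T (pairElemᵇ p xs)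
pairElemᵇ⁺ {a , b} xs p∈ = any⁺ (pairEqᵇ (a , b)) (Any.map (λ { refl → Equivalence.from T-∧ (≡⇒≡ᵇ a a refl , ≡⇒≡ᵇ b b refl) }) p∈)

_≋_ : List Pair → List Pair → Set
A ≋ B = A ⊆ B × B ⊆ A

sameSetᵇ⁻ : ∀ A B → T (sameSetᵇ A B) → A ≋ B
sameSetᵇ⁻ A B t with Equivalence.to T-∧ t
... | A⊆B , B⊆A = (λ p∈ → pairElemᵇ⁻ B (All.lookup (all⁺ _ A A⊆B) p∈))
                , (λ p∈ → pairElemᵇ⁻ A (All.lookup (all⁺ _ B B⊆A) p∈))

sameSetᵇ⁺ : ∀ A B → A ≋ B → T (sameSetᵇ A B)
sameSetᵇ⁺ A B (A⊆B , B⊆A) = Equivalence.from T-∧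
  (all⁻ _ (All.tabulate (pairElemᵇ⁺ B ∘ A⊆B)) , all⁻ _ (All.tabulate (pairElemᵇ⁺ A ∘ B⊆A)))

record Inversion (h : ℕ → ℕ) (n : ℕ) (π : List ℕ) (i j : ℕ) : Set where
  constructor inversion
  field
    1≤i     : 1 ≤ i
    i<j     : i < j
    j≤n     : j ≤ n
    j≤h     : j ≤ h i
    descent : at π j < at π i

module _ (h : ℕ → ℕ) (n : ℕ) (π : List ℕ) where
  private
    descends : ℕ → ℕ → Bool
    descends i j = (j ≤ᵇ h i) ∧ (at π j <ᵇ at π i)

    row : ℕ → List Pair
    row i = map (i ,_) (filterᵇ (descends i) (interval (suc i) n))

  inv⁻ : ∀ {i j} → (i , j) ∈ inv h n π → Inversion h n π i j
  inv⁻ ij∈ with find (∈-concatMap⁻ row {xs = interval 1 n} ij∈)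
  ... | i , i∈ , ij∈row with ∈-map⁻ (i ,_) ij∈row
  ... | j , j∈ , refl with ∈-filter⁻ (T? ∘ descends i) {xs = interval (suc i) n} j∈
  ... | j∈′ , t with Equivalence.to T-∧ t | ∈-interval⁻ 1 n i∈ | ∈-interval⁻ (suc i) n j∈′
  ... | j≤h , πj<πi | 1≤i , _ | i<j , j≤n = inversion 1≤i i<j j≤n (≤ᵇ⇒≤ j (h i) j≤h) (<ᵇ⇒< _ _ πj<πi)

  inv⁺ : ∀ {i j} → Inversion h n π i j → (i , j) ∈ inv h n π
  inv⁺ {i} {j} (inversion 1≤i i<j j≤n j≤h πj<πi) = ∈-concatMap⁺ row (lose (∈-interval⁺ 1 n 1≤i (≤-trans (<⇒≤ i<j) j≤n))
    (∈-map⁺ (i ,_) (∈-filter⁺ (T? ∘ descends i) (∈-interval⁺ (suc i) n i<j j≤n) (Equivalence.from T-∧ (≤⇒≤ᵇ j≤h , <⇒<ᵇ πj<πi)))))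

adjacent-descent : ∀ π {i j} → i < j → at π j < at π i → ∃ λ l → i ≤ l × l < j × at π (suc l) < at π l
adjacent-descent π {i} {suc j} (s≤s i≤j) πj+1<πi with m≤n⇒m<n∨m≡n i≤j
... | inj₂ refl = i , ≤-refl , ≤-refl , πj+1<πi
... | inj₁ i<j with at π j <? at π i
...   | yes πj<πi = let l , i≤l , l<j , d = adjacent-descent π i<j πj<πi in l , i≤l , m<n⇒m<1+n l<j , d
...   | no  πj≮πi = j , i≤j , ≤-refl , <-≤-trans πj+1<πi (≮⇒≥ πj≮πi)

module _ (h : ℕ → ℕ) {n i j : ℕ} {π : List ℕ} {v : ℕ} (len : length π ≡ n) (j≤n : j ≤ n) where
  private
    at-extendⁿ : ∀ {k} → 1 ≤ k → k ≤ j → at (extend π v) k ≡ shift v (at π k)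
    at-extendⁿ 1≤k k≤j = at-extend π v 1≤k (subst (_ ≤_) (sym len) (≤-trans k≤j j≤n))

  Inversion-extend⁺ : Inversion h n π i j → Inversion h (suc n) (extend π v) i j
  Inversion-extend⁺ (inversion 1≤i i<j _ j≤h πj<πi) = inversion 1≤i i<j (m≤n⇒m≤1+n j≤n) j≤h
    (subst₂ _<_ (sym (at-extendⁿ (≤-trans 1≤i (<⇒≤ i<j)) ≤-refl)) (sym (at-extendⁿ 1≤i (<⇒≤ i<j))) (shift-mono-< v πj<πi))

  Inversion-extend⁻ : Inversion h (suc n) (extend π v) i j → Inversion h n π i j
  Inversion-extend⁻ (inversion 1≤i i<j _ j≤h πj<πi) = inversion 1≤i i<j j≤n j≤h
    (shift-cancel-< v (subst₂ _<_ (at-extendⁿ (≤-trans 1≤i (<⇒≤ i<j)) ≤-refl) (at-extendⁿ 1≤i (<⇒≤ i<j)) πj<πi))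

module AdmissibleSet (h : ℕ → ℕ) (h-mono : ∀ i j → 1 ≤ i → i ≤ j → h i ≤ h j) (h-gt : ∀ i → 1 ≤ i → i < h i)
               (S : List Pair) (admissible : Admissible h S) (S≢[] : S ≢ []) where

  m : ℕ
  m = mS S

  M : ℕ
  M = h m

  adjacent∈S⇒≤m : ∀ {l} → (l , suc l) ∈ S → l ≤ m
  adjacent∈S⇒≤m {l} l∈ = ∈⇒≤foldr-⊔ _ (∈-map⁺ proj₁ (∈-filter⁺ (T? ∘ λ p → suc (proj₁ p) ≡ᵇ proj₂ p) l∈ (≡⇒≡ᵇ l l refl)))

  private
    n₀ = proj₁ admissible
    π₀ = proj₁ (proj₂ admissible)

    inv₀≋S : inv h n₀ π₀ ≋ S
    inv₀≋S = sameSetᵇ⁻ (inv h n₀ π₀) S (proj₂ (proj₂ (proj₂ admissible)))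

  -- Between i and j the witness permutation must descend at some l, and then (l, l+1) ∈ S.
  ∈S⇒bounds : ∀ {i j} → (i , j) ∈ S → 1 ≤ i × i ≤ m × j ≤ M
  ∈S⇒bounds ij∈ with inv⁻ h n₀ π₀ (proj₂ inv₀≋S ij∈)
  ... | inversion 1≤i i<j j≤n₀ j≤h πj<πi with adjacent-descent π₀ i<j πj<πi
  ... | l , i≤l , l<j , πl+1<πl = 1≤i , i≤m , ≤-trans j≤h (h-mono _ m 1≤i i≤m)
    where
    1≤l = ≤-trans 1≤i i≤l
    i≤m = ≤-trans i≤l (adjacent∈S⇒≤m (proj₁ inv₀≋S (inv⁺ h n₀ π₀ (inversion 1≤l ≤-refl (≤-trans l<j j≤n₀) (h-gt l 1≤l) πl+1<πl))))

  1≤m : 1 ≤ m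
  1≤m with ≢[]⇒∃∈ S≢[]
  ... | _ , ij∈ = let 1≤i , i≤m , _ = ∈S⇒bounds ij∈ in ≤-trans 1≤i i≤m

  m<M : m < M
  m<M = h-gt m 1≤m

  m≤M : m ≤ M
  m≤M = <⇒≤ m<M

  1≤M : 1 ≤ M
  1≤M = ≤-trans 1≤m m≤M

  tail-ascending : ∀ {n π} → inv h n π ⊆ S → ∀ {p q} → m < p → p ≤ q → q ≤ n → at π p ≤ at π q
  tail-ascending {n} {π} inv⊆S {p} m<p p≤q q≤n with m≤n⇒m<n∨m≡n p≤q
  ... | inj₂ refl = ≤-refl
  tail-ascending {n} {π} inv⊆S {p} {suc q} m<p _ q+1≤n | inj₁ p<q+1 =
    ≤-trans (tail-ascending {n} {π} inv⊆S m<p (≤-pred p<q+1) (<⇒≤ q+1≤n)) step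
    where
    step : at π q ≤ at π (suc q)
    step with at π (suc q) <? at π q
    ... | no  πq+1≮πq = ≮⇒≥ πq+1≮πq
    ... | yes πq+1<πq = ⊥-elim (<⇒≱ m<q (adjacent∈S⇒≤m (inv⊆S (inv⁺ h n π (inversion 1≤q ≤-refl q+1≤n (h-gt q 1≤q) πq+1<πq)))))
      where
      m<q = <-≤-trans m<p (≤-pred p<q+1)
      1≤q = ≤-trans 1≤m (<⇒≤ m<q)

  module _ {n : ℕ} {π : List ℕ} {v : ℕ} (len : length π ≡ n) (M≤n : M ≤ n) where
    private
      m<n : m < n
      m<n = <-≤-trans m<M M≤n
      1≤n : 1 ≤ n
      1≤n = ≤-trans 1≤M M≤n
      at-extendⁿ : ∀ {i} → 1 ≤ i → i ≤ n → at (extend π v) i ≡ shift v (at π i)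
      at-extendⁿ {i} 1≤i i≤n = at-extend π v 1≤i (subst (i ≤_) (sym len) i≤n)
      at-extend-lastⁿ : at (extend π v) (suc n) ≡ v
      at-extend-lastⁿ = subst (λ k → at (extend π v) (suc k) ≡ v) len (at-extend-last π v)
      ∈S⇒≤n : ∀ {i j} → (i , j) ∈ S → j ≤ n
      ∈S⇒≤n ij∈ = ≤-trans (proj₂ (proj₂ (∈S⇒bounds ij∈))) M≤n

    extend-≋S⁻ : inv h (suc n) (extend π v) ≋ S → inv h n π ≋ S × at π n < v
    extend-≋S⁻ (inv⁺⊆S , S⊆inv⁺) = (inv⊆S , S⊆inv) , πn<v
      where
      inv⊆S : inv h n π ⊆ S
      inv⊆S {i , j} ij∈ = let I = inv⁻ h n π ij∈ in
        inv⁺⊆S (inv⁺ h (suc n) (extend π v) (Inversion-extend⁺ h len (Inversion.j≤n I) I))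
      S⊆inv : S ⊆ inv h n π
      S⊆inv {i , j} ij∈ = inv⁺ h n π (Inversion-extend⁻ h len (∈S⇒≤n ij∈) (inv⁻ h (suc n) (extend π v) (S⊆inv⁺ ij∈)))
      πn<v : at π n < v
      πn<v with at π n <? v
      ... | yes πn<v = πn<v
      ... | no  πn≮v = ⊥-elim (<⇒≱ m<n (adjacent∈S⇒≤m (inv⁺⊆S (inv⁺ h (suc n) (extend π v)
              (inversion 1≤n ≤-refl ≤-refl (h-gt n 1≤n)
                (subst₂ _<_ (sym at-extend-lastⁿ) (sym (at-extendⁿ 1≤n ≤-refl)) (v≤⇒v<shift (≮⇒≥ πn≮v))))))))

    extend-≋S⁺ : inv h n π ≋ S → at π n < v → inv h (suc n) (extend π v) ≋ S
    extend-≋S⁺ (inv⊆S , S⊆inv) πn<v = inv⁺⊆S , S⊆inv⁺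
      where
      no-inversion-at-end : ∀ {i} → ¬ Inversion h (suc n) (extend π v) i (suc n)
      no-inversion-at-end {i} (inversion 1≤i i<n+1 _ n+1≤h v<πi) with m <? i
      ... | yes m<i = <⇒≱ (≤-<-trans (tail-ascending {n} {π} inv⊆S m<i (≤-pred i<n+1) ≤-refl) πn<v)
                          (v<shift⇒v≤ (subst₂ _<_ at-extend-lastⁿ (at-extendⁿ 1≤i (≤-pred i<n+1)) v<πi))
      ... | no  m≮i = <⇒≱ (s≤s M≤n) (≤-trans n+1≤h (h-mono i m 1≤i (≮⇒≥ m≮i)))
      inv⁺⊆S : inv h (suc n) (extend π v) ⊆ S
      inv⁺⊆S {i , j} ij∈ with inv⁻ h (suc n) (extend π v) ij∈
      ... | I with m≤n⇒m<n∨m≡n (Inversion.j≤n I)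
      ... | inj₁ j<n+1 = inv⊆S (inv⁺ h n π (Inversion-extend⁻ h len (≤-pred j<n+1) I))
      ... | inj₂ refl  = ⊥-elim (no-inversion-at-end I)
      S⊆inv⁺ : S ⊆ inv h (suc n) (extend π v)
      S⊆inv⁺ {i , j} ij∈ = inv⁺ h (suc n) (extend π v) (Inversion-extend⁺ h len (∈S⇒≤n ij∈) (inv⁻ h n π (S⊆inv ij∈)))

    sameSetᵇ-extend : sameSetᵇ (inv h (suc n) (extend π v)) S ≡ sameSetᵇ (inv h n π) S ∧ (at π n <ᵇ v)
    sameSetᵇ-extend = T-ext
      (λ t → let ≋S , πn<v = extend-≋S⁻ (sameSetᵇ⁻ _ S t) in Equivalence.from T-∧ (sameSetᵇ⁺ _ S ≋S , <⇒<ᵇ πn<v))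
      (λ t → let ≋S , πn<v = Equivalence.to T-∧ t in sameSetᵇ⁺ _ S (extend-≋S⁺ (sameSetᵇ⁻ _ S ≋S) (<ᵇ⇒< _ _ πn<v)))

  Iᵇ : ℕ → List ℕ → Bool
  Iᵇ n π = sameSetᵇ (inv h n π) S

  ΣI : ℕ → (List ℕ → ℕ) → ℕ
  ΣI n F = sum (map (λ π → χ (Iᵇ n π) * F π) (perms n))

  countI≡ΣI : ∀ n P → countI h S n P ≡ ΣI n (χ ∘ P)
  countI≡ΣI n P = trans (count-Sym n (λ π → Iᵇ n π ∧ P π)) (sum-map-cong (perms n) (λ {π} _ → χ-∧ (Iᵇ n π) (P π)))

  ΣI-cong : ∀ n {F G : List ℕ → ℕ} → (∀ {π} → IsPerm n π → inv h n π ≋ S → F π ≡ G π) → ΣI n F ≡ ΣI n G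
  ΣI-cong n {F} {G} F≗G = sum-map-cong (perms n) pointwise
    where
    pointwise : ∀ {π} → π ∈ perms n → χ (Iᵇ n π) * F π ≡ χ (Iᵇ n π) * G π
    pointwise {π} π∈ with Iᵇ n π in good
    ... | false = refl
    ... | true  = cong (1 *_) (F≗G (perms⇒IsPerm n π∈) (sameSetᵇ⁻ _ S (subst T (sym good) _)))

  ΣI-+ : ∀ n (F G : List ℕ → ℕ) → ΣI n (λ π → F π + G π) ≡ ΣI n F + ΣI n G
  ΣI-+ n F G = trans (sum-map-cong (perms n) (λ {π} _ → *-distribˡ-+ (χ (Iᵇ n π)) (F π) (G π)))
                     (sum-map-+ (λ π → χ (Iᵇ n π) * F π) (λ π → χ (Iᵇ n π) * G π) (perms n))

  ΣI-*ʳ : ∀ n c (F : List ℕ → ℕ) → ΣI n (λ π → F π * c) ≡ c * ΣI n F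
  ΣI-*ʳ n c F = trans (sum-map-cong (perms n) (λ {π} _ → rearrange (χ (Iᵇ n π)) (F π)))
                      (sum-map-*ˡ c (λ π → χ (Iᵇ n π) * F π) (perms n))
    where
    rearrange : ∀ a b → a * (b * c) ≡ c * (a * b)
    rearrange a b = trans (sym (*-assoc a b c)) (*-comm (a * b) c)

  ΣI-zero : ∀ n → ΣI n (λ _ → 0) ≡ 0
  ΣI-zero n = sum-map-zero (perms n) (λ {π} _ → *-zeroʳ (χ (Iᵇ n π)))

  ΣI-sum : ∀ {A : Set} n (H : A → List ℕ → ℕ) rs → ΣI n (λ π → sum (map (λ r → H r π) rs)) ≡ sum (map (λ r → ΣI n (H r)) rs)
  ΣI-sum n H []       = ΣI-zero n
  ΣI-sum n H (r ∷ rs) = trans (ΣI-+ n (H r) _) (cong (ΣI n (H r) +_) (ΣI-sum n H rs))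

  ΣI-suc : ∀ n (F : List ℕ → ℕ) → M ≤ n →
    ΣI (suc n) F ≡ ΣI n (λ π → sum (map (F ∘ extend π) (interval (suc (at π n)) (suc n))))
  ΣI-suc n F M≤n = trans (sum-cartesianProductWith (λ π → χ (Iᵇ (suc n) π) * F π) extend (perms n) (interval 1 (suc n)))
                         (sum-map-cong (perms n) (λ π∈ → extensions (perms⇒IsPerm n π∈)))
    where
    extensions : ∀ {π} → IsPerm n π →
      sum (map (λ v → χ (Iᵇ (suc n) (extend π v)) * F (extend π v)) (interval 1 (suc n)))
        ≡ χ (Iᵇ n π) * sum (map (F ∘ extend π) (interval (suc (at π n)) (suc n)))
    extensions {π} p = begin
      sum (map (λ v → χ (Iᵇ (suc n) (extend π v)) * F (extend π v)) (interval 1 (suc n)))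
        ≡⟨ sum-map-cong (interval 1 (suc n)) (λ {v} _ → split v) ⟩
      sum (map (λ v → χ (Iᵇ n π) * (χ (at π n <ᵇ v) * F (extend π v))) (interval 1 (suc n)))
        ≡⟨ sum-map-*ˡ (χ (Iᵇ n π)) _ (interval 1 (suc n)) ⟩
      χ (Iᵇ n π) * sum (map (λ v → χ (at π n <ᵇ v) * F (extend π v)) (interval 1 (suc n)))
        ≡⟨ cong (χ (Iᵇ n π) *_) (sum-χ-<ᵇ (F ∘ extend π) (at π n) (suc n) (m≤n⇒m≤1+n (proj₂ (IsPerm.at-bounded p 1≤n ≤-refl)))) ⟩
      χ (Iᵇ n π) * sum (map (F ∘ extend π) (interval (suc (at π n)) (suc n))) ∎
      where
      open ≡-Reasoning
      1≤n = ≤-trans 1≤M M≤n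
      split : ∀ v → χ (Iᵇ (suc n) (extend π v)) * F (extend π v) ≡ χ (Iᵇ n π) * (χ (at π n <ᵇ v) * F (extend π v))
      split v = begin
        χ (Iᵇ (suc n) (extend π v)) * F (extend π v)           ≡⟨ cong (λ b → χ b * F (extend π v)) (sameSetᵇ-extend {π = π} {v = v} (IsPerm.length≡ p) M≤n) ⟩
        χ (Iᵇ n π ∧ (at π n <ᵇ v)) * F (extend π v)            ≡⟨ cong (_* F (extend π v)) (χ-∧ (Iᵇ n π) _) ⟩
        χ (Iᵇ n π) * χ (at π n <ᵇ v) * F (extend π v)          ≡⟨ *-assoc (χ (Iᵇ n π)) _ _ ⟩
        χ (Iᵇ n π) * (χ (at π n <ᵇ v) * F (extend π v))        ∎

  -- The local eqB of Defs.a, so that a h S k unfolds to countI h S N (aCond k N).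
  eqB : Bool → Bool → Bool
  eqB x y = (x ∧ y) ∨ (not x ∧ not y)

  aCondAt : ℕ → List ℕ → ℕ → Bool
  aCondAt k π u = eqB (elemᵇ u (take m π)) (u <ᵇ M + k)

  aCond : ℕ → ℕ → List ℕ → Bool
  aCond k n π = all (aCondAt k π) (interval M n)

  module _ {k n : ℕ} {π : List ℕ} (p : IsPerm n π) (M≤n : M ≤ n) (M+k≤n+1 : M + k ≤ suc n) where
    open IsPerm p

    aCond-append-top : aCond k (suc n) (π ++ [ suc n ]) ≡ aCond k n π
    aCond-append-top = begin
      all (aCondAt k (π ++ [ suc n ])) (interval M (suc n))
        ≡⟨ cong (λ xs → all (λ u → eqB (elemᵇ u xs) (u <ᵇ M + k)) (interval M (suc n))) (take-++ˡ m π _ m≤len) ⟩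
      all (aCondAt k π) (interval M (suc n))
        ≡⟨ cong (all (aCondAt k π)) (interval-∷ʳ M n (m≤n⇒m≤1+n M≤n)) ⟩
      all (aCondAt k π) (interval M n ++ [ suc n ])
        ≡⟨ all-++ (aCondAt k π) (interval M n) _ ⟩
      aCond k n π ∧ (eqB (elemᵇ (suc n) (take m π)) (suc n <ᵇ M + k) ∧ true)
        ≡⟨ cong₂ (λ x y → aCond k n π ∧ (eqB x y ∧ true)) top∉head (<ᵇ-false M+k≤n+1) ⟩
      aCond k n π ∧ true
        ≡⟨ ∧-identityʳ _ ⟩
      aCond k n π ∎
      where
      open ≡-Reasoning
      m≤len : m ≤ length π
      m≤len = subst (m ≤_) (sym length≡) (≤-trans m≤M M≤n)
      top∉head : elemᵇ (suc n) (take m π) ≡ false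
      top∉head = ¬T⇒≡false (λ t → 1+n≰n (proj₂ (bounded (∈-take⇒∈ m π (elemᵇ⁻ (take m π) t)))))

    -- The tail of π ascends, so the value n sits among the first m places, where v ≤ n turns it into n + 1.
    top∈head-extend : ∀ {v} → inv h n π ⊆ S → at π n < v → v ≤ n → suc n ∈ take m (extend π v)
    top∈head-extend {v} inv⊆S πn<v v≤n = from-position (∈⇒at π (complete (≤-trans 1≤M M≤n) ≤-refl))
      where
      from-position : (∃ λ q → 1 ≤ q × q ≤ length π × at π q ≡ n) → suc n ∈ take m (extend π v)
      from-position (q , 1≤q , q≤len , πq≡n) with m <? q
      ... | yes m<q = ⊥-elim (<⇒≱ (<-≤-trans πn<v v≤n) (subst (_≤ at π n) πq≡n
                        (tail-ascending {n} {π} inv⊆S m<q (subst (q ≤_) length≡ q≤len) ≤-refl)))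
      ... | no  m≮q = subst (_∈ take m (extend π v)) (trans (at-extend π v 1≤q q≤len) (trans (cong (shift v) πq≡n) (shift-≥ v≤n)))
                        (∈-take⁺ m (extend π v) q 1≤q (≮⇒≥ m≮q) (subst (q ≤_) (sym (length-extend π v)) (m≤n⇒m≤1+n q≤len)))

    aCond-extend-below : ∀ {v} → inv h n π ⊆ S → at π n < v → v ≤ n → aCond k (suc n) (extend π v) ≡ false
    aCond-extend-below {v} inv⊆S πn<v v≤n = ¬T⇒≡false (λ t →
      subst₂ (λ x y → T (eqB x y)) (T⇒≡true (elemᵇ⁺ _ (top∈head-extend inv⊆S πn<v v≤n))) (<ᵇ-false M+k≤n+1)
        (all-interval⁻ {p = aCondAt k (extend π v)} {a = M} {b = suc n} t (m≤n⇒m≤1+n M≤n) ≤-refl))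

  ΣI-aCond-suc : ∀ k n → M ≤ n → M + k ≤ suc n → ΣI (suc n) (χ ∘ aCond k (suc n)) ≡ ΣI n (χ ∘ aCond k n)
  ΣI-aCond-suc k n M≤n M+k≤n+1 = trans (ΣI-suc n (χ ∘ aCond k (suc n)) M≤n) (ΣI-cong n only-top)
    where
    only-top : ∀ {π} → IsPerm n π → inv h n π ≋ S →
      sum (map (χ ∘ aCond k (suc n) ∘ extend π) (interval (suc (at π n)) (suc n))) ≡ χ (aCond k n π)
    only-top {π} p (inv⊆S , _) = begin
      sum (map F (interval (suc (at π n)) (suc n)))                ≡⟨ cong (sum ∘ map F) (interval-∷ʳ (suc (at π n)) n (s≤s πn≤n)) ⟩
      sum (map F (interval (suc (at π n)) n ++ [ suc n ]))         ≡⟨ cong sum (map-++ F (interval (suc (at π n)) n) _) ⟩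
      sum (map F (interval (suc (at π n)) n) ++ [ F (suc n) ])     ≡⟨ sum-++ (map F (interval (suc (at π n)) n)) _ ⟩
      sum (map F (interval (suc (at π n)) n)) + (F (suc n) + 0)    ≡⟨ cong₂ _+_ (sum-map-zero _ below) (+-identityʳ _) ⟩
      F (suc n)                                                    ≡⟨ cong (χ ∘ aCond k (suc n)) (extend-top p) ⟩
      χ (aCond k (suc n) (π ++ [ suc n ]))                         ≡⟨ cong χ (aCond-append-top p M≤n M+k≤n+1) ⟩
      χ (aCond k n π)                                              ∎
      where
      open ≡-Reasoning
      F : ℕ → ℕ
      F = χ ∘ aCond k (suc n) ∘ extend π
      πn≤n = proj₂ (IsPerm.at-bounded p (≤-trans 1≤M M≤n) ≤-refl)
      below : ∀ {v} → v ∈ interval (suc (at π n)) n → F v ≡ 0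
      below v∈ = let πn<v , v≤n = ∈-interval⁻ _ n v∈ in cong χ (aCond-extend-below p M≤n M+k≤n+1 inv⊆S πn<v v≤n)

  ΣI-aCond-stable : ∀ k n d → M ≤ n → M + k ≤ suc n → ΣI (n + d) (χ ∘ aCond k (n + d)) ≡ ΣI n (χ ∘ aCond k n)
  ΣI-aCond-stable k n zero    _   _       = cong (λ n → ΣI n (χ ∘ aCond k n)) (+-identityʳ n)
  ΣI-aCond-stable k n (suc d) M≤n M+k≤n+1 = begin
    ΣI (n + suc d) (χ ∘ aCond k (n + suc d))   ≡⟨ cong (λ n → ΣI n (χ ∘ aCond k n)) (+-suc n d) ⟩
    ΣI (suc (n + d)) (χ ∘ aCond k (suc (n + d))) ≡⟨ ΣI-aCond-suc k (n + d) (≤-trans M≤n (m≤m+n n d)) (≤-trans M+k≤n+1 (s≤s (m≤m+n n d))) ⟩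
    ΣI (n + d) (χ ∘ aCond k (n + d))           ≡⟨ ΣI-aCond-stable k n d M≤n M+k≤n+1 ⟩
    ΣI n (χ ∘ aCond k n)                       ∎
    where open ≡-Reasoning

  covers : ℕ → ℕ → List ℕ → Bool
  covers t n π = all (λ u → elemᵇ u (take m π)) (interval t n)

  covers⁻ : ∀ {t n π} → T (covers t n π) → ∀ {u} → t ≤ u → u ≤ n → u ∈ take m π
  covers⁻ {t} {n} {π} c t≤u u≤n = elemᵇ⁻ (take m π) (all-interval⁻ {p = λ u → elemᵇ u (take m π)} {a = t} {b = n} c t≤u u≤n)

  covers⁺ : ∀ {t n π} → (∀ {u} → t ≤ u → u ≤ n → u ∈ take m π) → T (covers t n π)
  covers⁺ {t} {n} {π} c = all-interval⁺ {p = λ u → elemᵇ u (take m π)} {a = t} {b = n} (λ t≤u u≤n → elemᵇ⁺ (take m π) (c t≤u u≤n))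

  covers-extend : ∀ {t n π v} → length π ≡ n → m ≤ n → v ≤ suc n →
    covers (suc t) (suc n) (extend π v) ≡ (v ≤ᵇ t) ∧ covers t n π
  covers-extend {t} {n} {π} {v} len m≤n v≤n+1 = T-ext to from
    where
    head≡ : take m (extend π v) ≡ map (shift v) (take m π)
    head≡ = trans (take-++ˡ m (map (shift v) π) [ v ] (subst (m ≤_) (sym (trans (length-map (shift v) π) len)) m≤n)) (take-map m π)
    v≤t : T (covers (suc t) (suc n) (extend π v)) → v ≤ t
    v≤t c with v ≤? t
    ... | yes v≤t = v≤t
    ... | no  v≰t with ∈-map⁻ (shift v) (subst (v ∈_) head≡ (covers⁻ {suc t} {suc n} {extend π v} c (≰⇒> v≰t) v≤n+1))
    ...   | _ , _ , v≡shift = ⊥-elim (shift-≢ (sym v≡shift))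
    to : T (covers (suc t) (suc n) (extend π v)) → T ((v ≤ᵇ t) ∧ covers t n π)
    to c = Equivalence.from T-∧ (≤⇒≤ᵇ (v≤t c) , covers⁺ {t} {n} {π} λ {u} t≤u u≤n →
      let y , y∈ , u+1≡shift = ∈-map⁻ (shift v) (subst (suc u ∈_) head≡ (covers⁻ {suc t} {suc n} {extend π v} c (s≤s t≤u) (s≤s u≤n)))
      in subst (_∈ take m π) (shift-injective v (trans (sym u+1≡shift) (sym (shift-≥ (≤-trans (v≤t c) t≤u))))) y∈)
    from : T ((v ≤ᵇ t) ∧ covers t n π) → T (covers (suc t) (suc n) (extend π v))
    from vc with Equivalence.to (T-∧ {v ≤ᵇ t} {covers t n π}) vc
    ... | v≤ᵇt , c = covers⁺ {suc t} {suc n} {extend π v} λ { {suc u} (s≤s t≤u) (s≤s u≤n) → subst (suc u ∈_) (sym head≡)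
            (subst (_∈ map (shift v) (take m π)) (shift-≥ (≤-trans (≤ᵇ⇒≤ v t v≤ᵇt) t≤u)) (∈-map⁺ (shift v) (covers⁻ {t} {n} {π} c t≤u u≤n))) }

  Σcovers : ℕ → ℕ → (ℕ → ℕ) → ℕ
  Σcovers n t f = ΣI n (λ π → χ (covers t n π) * f (at π n))

  Σcovers-suc : ∀ {n} t (f : ℕ → ℕ) → M ≤ n →
    Σcovers (suc n) (suc t) f ≡ Σcovers n t (λ x → sum (map (λ v → χ (v ≤ᵇ t) * f v) (interval (suc x) (suc n))))
  Σcovers-suc {n} t f M≤n = trans (ΣI-suc n _ M≤n) (ΣI-cong n pointwise)
    where
    pointwise : ∀ {π} → IsPerm n π → inv h n π ≋ S →
      sum (map (λ v → χ (covers (suc t) (suc n) (extend π v)) * f (at (extend π v) (suc n))) (interval (suc (at π n)) (suc n)))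
        ≡ χ (covers t n π) * sum (map (λ v → χ (v ≤ᵇ t) * f v) (interval (suc (at π n)) (suc n)))
    pointwise {π} p _ = trans (sum-map-cong (interval (suc (at π n)) (suc n)) per-v) (sum-map-*ˡ (χ (covers t n π)) (λ v → χ (v ≤ᵇ t) * f v) (interval (suc (at π n)) (suc n)))
      where
      per-v : ∀ {v} → v ∈ interval (suc (at π n)) (suc n) →
        χ (covers (suc t) (suc n) (extend π v)) * f (at (extend π v) (suc n)) ≡ χ (covers t n π) * (χ (v ≤ᵇ t) * f v)
      per-v {v} v∈ = begin
        χ (covers (suc t) (suc n) (extend π v)) * f (at (extend π v) (suc n))
          ≡⟨ cong₂ (λ b x → χ b * f x) (covers-extend {t} {n} {π} {v} (IsPerm.length≡ p) (≤-trans m≤M M≤n) (proj₂ (∈-interval⁻ _ _ v∈)))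
                                         (subst (λ k → at (extend π v) (suc k) ≡ v) (IsPerm.length≡ p) (at-extend-last π v)) ⟩
        χ ((v ≤ᵇ t) ∧ covers t n π) * f v            ≡⟨ cong (_* f v) (χ-∧ (v ≤ᵇ t) _) ⟩
        χ (v ≤ᵇ t) * χ (covers t n π) * f v          ≡⟨ cong (_* f v) (*-comm (χ (v ≤ᵇ t)) _) ⟩
        χ (covers t n π) * χ (v ≤ᵇ t) * f v          ≡⟨ *-assoc (χ (covers t n π)) _ _ ⟩
        χ (covers t n π) * (χ (v ≤ᵇ t) * f v)        ∎
        where open ≡-Reasoning

  binom : ℕ → ℕ → ℕ
  binom s x = (M ∸ 1 ∸ x) C s

  Σcovers-binom-suc : ∀ {n t} s → M ≤ n → t ≤ suc n → t + s ≡ M ∸ 1 →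
    Σcovers (suc n) (suc t) (binom s) ≡ Σcovers n t (binom (suc s))
  Σcovers-binom-suc {n} {t} s M≤n t≤n+1 t+s≡M-1 = trans (Σcovers-suc t (binom s) M≤n) (ΣI-cong n hockey)
    where
    hockey : ∀ {π} → IsPerm n π → inv h n π ≋ S →
      χ (covers t n π) * sum (map (λ v → χ (v ≤ᵇ t) * binom s v) (interval (suc (at π n)) (suc n)))
        ≡ χ (covers t n π) * binom (suc s) (at π n)
    hockey {π} _ _ = cong (χ (covers t n π) *_) (begin
      sum (map (λ v → χ (v ≤ᵇ t) * ((M ∸ 1 ∸ v) C s)) (interval (suc (at π n)) (suc n)))
        ≡⟨ cong (λ L → sum (map (λ v → χ (v ≤ᵇ t) * ((L ∸ v) C s)) (interval (suc (at π n)) (suc n)))) (sym t+s≡M-1) ⟩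
      sum (map (λ v → χ (v ≤ᵇ t) * ((t + s ∸ v) C s)) (interval (suc (at π n)) (suc n)))
        ≡⟨ hockey-stick s t (suc (at π n)) (suc n) t≤n+1 ⟩
      (t + s ∸ at π n) C suc s
        ≡⟨ cong (λ L → (L ∸ at π n) C suc s) t+s≡M-1 ⟩
      binom (suc s) (at π n) ∎)
      where open ≡-Reasoning

  Σcovers-binom : ∀ d {n t} s → M ≤ n → t ≤ suc n → t + d + s ≡ M →
    Σcovers (n + d) (t + d) (binom s) ≡ Σcovers n t (binom (s + d))
  Σcovers-binom zero {n} {t} s _ _ _ rewrite +-identityʳ n | +-identityʳ t | +-identityʳ s = refl
  Σcovers-binom (suc d) {n} {t} s M≤n t≤n+1 t+d+1+s≡M = begin
    Σcovers (n + suc d) (t + suc d) (binom s)  ≡⟨ cong₂ (λ n′ t′ → Σcovers n′ t′ (binom s)) (+-suc n d) (+-suc t d) ⟩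
    Σcovers (suc (n + d)) (suc (t + d)) (binom s)
      ≡⟨ Σcovers-binom-suc s (≤-trans M≤n (m≤m+n n d)) (+-monoˡ-≤ d t≤n+1) (cong (_∸ 1) t+d+1+s≡M′) ⟩
    Σcovers (n + d) (t + d) (binom (suc s))    ≡⟨ Σcovers-binom d (suc s) M≤n t≤n+1 (trans (+-suc (t + d) s) t+d+1+s≡M′) ⟩
    Σcovers n t (binom (suc s + d))            ≡⟨ cong (Σcovers n t ∘ binom) (sym (+-suc s d)) ⟩
    Σcovers n t (binom (s + suc d))            ∎
    where
    open ≡-Reasoning
    t+d+1+s≡M′ : suc (t + d + s) ≡ M
    t+d+1+s≡M′ = trans (cong (_+ s) (sym (+-suc t d))) t+d+1+s≡M

  module _ {σ : List ℕ} (p : IsPerm M σ) (inv⊆S : inv h M σ ⊆ S) where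
    open IsPerm p
    private
      M≤len : M ≤ length σ
      M≤len = ≤-reflexive (sym length≡)

    tail-strict : ∀ {q} → m < q → suc q ≤ M → at σ q < at σ (suc q)
    tail-strict {q} m<q q+1≤M = ≤∧≢⇒< (tail-ascending {M} {σ} inv⊆S m<q (n≤1+n q) q+1≤M) (<⇒≢ (n<1+n q) ∘ same-place)
      where
      same-place : at σ q ≡ at σ (suc q) → q ≡ suc q
      same-place = at-injective σ q (suc q) unique (≤-trans (s≤s z≤n) m<q) (≤-trans (n≤1+n q) (≤-trans q+1≤M M≤len))
                                                   (s≤s z≤n) (≤-trans q+1≤M M≤len)

    -- σ ascends strictly from place m + 1 on, starting at a value ≥ 1.
    ascent : ∀ {q} → m < q → q ≤ M → q ∸ m ≤ at σ q
    ascent {suc q} m<q+1 q+1≤M with m≤n⇒m<n∨m≡n (≤-pred m<q+1)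
    ... | inj₂ refl = subst (_≤ at σ (suc m)) (sym (trans (+-∸-assoc 1 (≤-refl {m})) (cong suc (n∸n≡0 m))))
                        (proj₁ (at-bounded (s≤s z≤n) q+1≤M))
    ... | inj₁ m<q  = begin
      suc q ∸ m       ≡⟨ +-∸-assoc 1 (<⇒≤ m<q) ⟩
      suc (q ∸ m)     ≤⟨ s≤s (ascent m<q (<⇒≤ q+1≤M)) ⟩
      suc (at σ q)    ≤⟨ tail-strict m<q q+1≤M ⟩
      at σ (suc q)    ∎
      where open ≤-Reasoning

    covers-base : ∀ t → covers (suc t) M σ ≡ (at σ M ≤ᵇ t)
    covers-base t = T-ext (λ c → ≤⇒≤ᵇ (last≤t c)) (λ σM≤t → covers⁺ {suc t} {M} {σ} (∈head (≤ᵇ⇒≤ _ t σM≤t)))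
      where
      σM-bounds = at-bounded 1≤M ≤-refl
      never-in-head : at σ M ∉ take m σ
      never-in-head σM∈ with ∈-take⁻ m σ σM∈
      ... | q , 1≤q , q≤m , q≤len , σq≡σM =
        <⇒≱ m<M (subst (_≤ m) (at-injective σ q M unique 1≤q q≤len 1≤M M≤len σq≡σM) q≤m)
      last≤t : T (covers (suc t) M σ) → at σ M ≤ t
      last≤t c with at σ M ≤? t
      ... | yes σM≤t = σM≤t
      ... | no  σM≰t = ⊥-elim (never-in-head (covers⁻ {suc t} {M} {σ} c (≰⇒> σM≰t) (proj₂ σM-bounds)))
      at-position : ∀ {u} → at σ M ≤ t → suc t ≤ u → (∃ λ q → 1 ≤ q × q ≤ length σ × at σ q ≡ u) → u ∈ take m σ
      at-position σM≤t t<u (q , 1≤q , q≤len , σq≡u) with m <? q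
      ... | yes m<q = ⊥-elim (<⇒≱ (≤-<-trans σM≤t t<u)
                        (subst (_≤ at σ M) σq≡u (tail-ascending {M} {σ} inv⊆S m<q (subst (q ≤_) length≡ q≤len) ≤-refl)))
      ... | no  m≮q = subst (_∈ take m σ) σq≡u (∈-take⁺ m σ q 1≤q (≮⇒≥ m≮q) q≤len)
      ∈head : at σ M ≤ t → ∀ {u} → suc t ≤ u → u ≤ M → u ∈ take m σ
      ∈head σM≤t t<u u≤M = at-position σM≤t t<u (∈⇒at σ (complete (≤-trans (s≤s z≤n) t<u) u≤M))

  Σcovers-base : ∀ t (f : ℕ → ℕ) → Σcovers M (suc t) f ≡ sum (map (λ r → f r * b h S r) (interval 1 t))
  Σcovers-base t f = begin
    Σcovers M (suc t) f
      ≡⟨ ΣI-cong M last-value-sum ⟩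
    ΣI M (λ σ → sum (map (λ r → χ (at σ M ≡ᵇ r) * f r) (interval 1 t)))
      ≡⟨ ΣI-sum M (λ r σ → χ (at σ M ≡ᵇ r) * f r) (interval 1 t) ⟩
    sum (map (λ r → ΣI M (λ σ → χ (at σ M ≡ᵇ r) * f r)) (interval 1 t))
      ≡⟨ sum-map-cong (interval 1 t) (λ {r} _ → trans (ΣI-*ʳ M (f r) _) (cong (f r *_) (sym (countI≡ΣI M (λ σ → at σ M ≡ᵇ r))))) ⟩
    sum (map (λ r → f r * b h S r) (interval 1 t)) ∎
    where
    open ≡-Reasoning
    last-value-sum : ∀ {σ} → IsPerm M σ → inv h M σ ≋ S →
      χ (covers (suc t) M σ) * f (at σ M) ≡ sum (map (λ r → χ (at σ M ≡ᵇ r) * f r) (interval 1 t))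
    last-value-sum {σ} p (inv⊆S , _) = trans (cong (λ b → χ b * f (at σ M)) (covers-base p inv⊆S t))
      (sym (sum-χ-≡ᵇ f (at σ M) t (proj₁ (IsPerm.at-bounded p 1≤M ≤-refl))))

  b-vanishes : ∀ {r} → r < M ∸ m → b h S r ≡ 0
  b-vanishes {r} r<M-m = trans (countI≡ΣI M (λ σ → at σ M ≡ᵇ r)) (trans (ΣI-cong M σM≢r) (ΣI-zero M))
    where
    σM≢r : ∀ {σ} → IsPerm M σ → inv h M σ ≋ S → χ (at σ M ≡ᵇ r) ≡ 0
    σM≢r p (inv⊆S , _) = cong χ (≡ᵇ-false (λ σM≡r → <⇒≱ r<M-m (subst (M ∸ m ≤_) σM≡r (ascent p inv⊆S m<M ≤-refl))))

  aCond-covers : ∀ {k n π} → n < M + k → aCond k n π ≡ covers M n π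
  aCond-covers {k} {n} {π} n<M+k = all-cong (interval M n) (λ {u} u∈ → trans
    (cong (eqB (elemᵇ u (take m π))) (<ᵇ-true (≤-<-trans (proj₂ (∈-interval⁻ M n u∈)) n<M+k))) (eqB-true (elemᵇ u (take m π))))
    where
    eqB-true : ∀ x → eqB x true ≡ x
    eqB-true false = refl
    eqB-true true  = refl

  aCond-zero : ∀ {σ} → aCond 0 M σ ≡ not (covers M M σ)
  aCond-zero {σ} rewrite interval-singleton M | <ᵇ-false (≤-reflexive (+-identityʳ M)) = eqB-false (elemᵇ M (take m σ))
    where
    eqB-false : ∀ x → eqB x false ∧ true ≡ not (x ∧ true)
    eqB-false false = refl
    eqB-false true  = refl

  a₀≡b-M : a h S 0 ≡ b h S M
  a₀≡b-M = begin
    a h S 0                                      ≡⟨ countI≡ΣI (m + M ∸ 1) (aCond 0 (m + M ∸ 1)) ⟩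
    ΣI (m + M ∸ 1) (χ ∘ aCond 0 (m + M ∸ 1))     ≡⟨ cong (λ n → ΣI n (χ ∘ aCond 0 n)) m+M∸1≡M+[m∸1] ⟩
    ΣI (M + (m ∸ 1)) (χ ∘ aCond 0 (M + (m ∸ 1))) ≡⟨ ΣI-aCond-stable 0 M (m ∸ 1) ≤-refl (≤-trans (≤-reflexive (+-identityʳ M)) (n≤1+n M)) ⟩
    ΣI M (χ ∘ aCond 0 M)                         ≡⟨ ΣI-cong M (λ p ≋S → cong χ (last-is-M p (proj₁ ≋S))) ⟩
    ΣI M (λ σ → χ (at σ M ≡ᵇ M))                 ≡⟨ sym (countI≡ΣI M (λ σ → at σ M ≡ᵇ M)) ⟩
    b h S M                                      ∎
    where
    open ≡-Reasoning
    m+M∸1≡M+[m∸1] : m + M ∸ 1 ≡ M + (m ∸ 1)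
    m+M∸1≡M+[m∸1] = trans (+-∸-comm M 1≤m) (+-comm (m ∸ 1) M)
    1+[M∸1]≡M : suc (M ∸ 1) ≡ M
    1+[M∸1]≡M = sym (+-∸-assoc 1 1≤M)
    last-is-M : ∀ {σ} → IsPerm M σ → inv h M σ ⊆ S → aCond 0 M σ ≡ (at σ M ≡ᵇ M)
    last-is-M {σ} p inv⊆S = begin
      aCond 0 M σ                      ≡⟨ aCond-zero ⟩
      not (covers M M σ)               ≡⟨ cong (λ t → not (covers t M σ)) (sym 1+[M∸1]≡M) ⟩
      not (covers (suc (M ∸ 1)) M σ)   ≡⟨ cong not (covers-base p inv⊆S (M ∸ 1)) ⟩
      not (at σ M ≤ᵇ M ∸ 1)            ≡⟨ T-ext (λ t → ≡⇒≡ᵇ _ _ (σM≡M t)) (λ t → ≡⇒T-not (≡ᵇ⇒≡ _ _ t)) ⟩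
      (at σ M ≡ᵇ M)                    ∎
      where
      σM≤M = proj₂ (IsPerm.at-bounded p 1≤M ≤-refl)
      σM≡M : T (not (at σ M ≤ᵇ M ∸ 1)) → at σ M ≡ M
      σM≡M t = ≤-antisym σM≤M (subst (_≤ at σ M) 1+[M∸1]≡M (≰⇒> (λ le → subst T (Equivalence.to T-not-≡ t) (≤⇒≤ᵇ le))))
      ≡⇒T-not : at σ M ≡ M → T (not (at σ M ≤ᵇ M ∸ 1))
      ≡⇒T-not σM≡M = Equivalence.from T-not-≡ (≤ᵇ-false (subst (M ∸ 1 <_) (sym σM≡M) (≤-reflexive 1+[M∸1]≡M)))

  Σbinom-b-reindex : ∀ k → 1 ≤ k → k ≤ m →
    sum (map (λ r → binom (k ∸ 1) r * b h S r) (interval 1 (M ∸ k)))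
      ≡ sum (map (λ j → ((j ∸ 1) C (k ∸ 1)) * b h S (M ∸ j)) (interval k m))
  Σbinom-b-reindex k 1≤k k≤m = begin
    sum (map φ (interval 1 (M ∸ k)))                             ≡⟨ sum-interval-reflect φ M k 1≤k (≤-trans k≤m m≤M) ⟩
    sum (map (λ j → φ (M ∸ j)) (interval k (M ∸ 1)))             ≡⟨ sum-map-cong (interval k (M ∸ 1)) (λ {j} j∈ → cong (λ i → (i C (k ∸ 1)) * b h S (M ∸ j)) (M∸1∸[M∸j] j∈)) ⟩
    sum (map ψ (interval k (M ∸ 1)))                             ≡⟨ cong (sum ∘ map ψ) (interval-++ k m (M ∸ 1) (m≤n⇒m≤1+n k≤m) m≤M∸1) ⟩
    sum (map ψ (interval k m ++ interval (suc m) (M ∸ 1)))       ≡⟨ cong sum (map-++ ψ (interval k m) _) ⟩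
    sum (map ψ (interval k m) ++ map ψ (interval (suc m) (M ∸ 1))) ≡⟨ sum-++ (map ψ (interval k m)) _ ⟩
    sum (map ψ (interval k m)) + sum (map ψ (interval (suc m) (M ∸ 1))) ≡⟨ cong (sum (map ψ (interval k m)) +_) (sum-map-zero (interval (suc m) (M ∸ 1)) beyond-m) ⟩
    sum (map ψ (interval k m)) + 0                               ≡⟨ +-identityʳ _ ⟩
    sum (map ψ (interval k m))                                   ∎
    where
    open ≡-Reasoning
    φ ψ : ℕ → ℕ
    φ r = binom (k ∸ 1) r * b h S r
    ψ j = ((j ∸ 1) C (k ∸ 1)) * b h S (M ∸ j)
    m≤M∸1 : m ≤ M ∸ 1
    m≤M∸1 = ≤-pred (subst (m <_) (+-∸-assoc 1 1≤M) m<M)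
    j≤M : ∀ {j} → j ≤ M ∸ 1 → j ≤ M
    j≤M j≤M∸1 = ≤-trans j≤M∸1 (m∸n≤m M 1)
    M∸1∸[M∸j] : ∀ {j} → j ∈ interval k (M ∸ 1) → M ∸ 1 ∸ (M ∸ j) ≡ j ∸ 1
    M∸1∸[M∸j] {j} j∈ = begin
      M ∸ 1 ∸ (M ∸ j)   ≡⟨ ∸-+-assoc M 1 (M ∸ j) ⟩
      M ∸ (1 + (M ∸ j)) ≡⟨ cong (M ∸_) (+-comm 1 (M ∸ j)) ⟩
      M ∸ (M ∸ j + 1)   ≡⟨ sym (∸-+-assoc M (M ∸ j) 1) ⟩
      M ∸ (M ∸ j) ∸ 1   ≡⟨ cong (_∸ 1) (m∸[m∸n]≡n (j≤M (proj₂ (∈-interval⁻ k (M ∸ 1) j∈)))) ⟩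
      j ∸ 1             ∎
    beyond-m : ∀ {j} → j ∈ interval (suc m) (M ∸ 1) → ψ j ≡ 0
    beyond-m {j} j∈ = let m<j , j≤M∸1 = ∈-interval⁻ (suc m) (M ∸ 1) j∈ in
      trans (cong (((j ∸ 1) C (k ∸ 1)) *_) (b-vanishes (∸-monoʳ-< m<j (j≤M j≤M∸1)))) (*-zeroʳ ((j ∸ 1) C (k ∸ 1)))

  aₖ-formula : ∀ k → 1 ≤ k → k ≤ m → a h S k ≡ sum (map (λ j → ((j ∸ 1) C (k ∸ 1)) * b h S (M ∸ j)) (interval k m))
  aₖ-formula k 1≤k k≤m = begin
    a h S k                                                   ≡⟨ countI≡ΣI (m + M ∸ 1) (aCond k (m + M ∸ 1)) ⟩
    ΣI (m + M ∸ 1) (χ ∘ aCond k (m + M ∸ 1))                  ≡⟨ cong (λ n → ΣI n (χ ∘ aCond k n)) m+M∸1≡nₖ+[m∸k] ⟩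
    ΣI (nₖ + (m ∸ k)) (χ ∘ aCond k (nₖ + (m ∸ k)))            ≡⟨ ΣI-aCond-stable k nₖ (m ∸ k) (m≤m+n M (k ∸ 1)) (≤-reflexive M+k≡1+nₖ) ⟩
    ΣI nₖ (χ ∘ aCond k nₖ)                                    ≡⟨ ΣI-cong nₖ (λ _ _ → trans (cong χ (aCond-covers nₖ<M+k)) (sym (*-identityʳ _))) ⟩
    Σcovers nₖ M (binom 0)                                    ≡⟨ cong (λ t → Σcovers nₖ t (binom 0)) (sym tₖ+[k∸1]≡M) ⟩
    Σcovers (M + (k ∸ 1)) (suc (M ∸ k) + (k ∸ 1)) (binom 0)   ≡⟨ Σcovers-binom (k ∸ 1) 0 ≤-refl (s≤s (m∸n≤m M k)) (trans (+-identityʳ _) tₖ+[k∸1]≡M) ⟩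
    Σcovers M (suc (M ∸ k)) (binom (k ∸ 1))                   ≡⟨ Σcovers-base (M ∸ k) (binom (k ∸ 1)) ⟩
    sum (map (λ r → binom (k ∸ 1) r * b h S r) (interval 1 (M ∸ k))) ≡⟨ Σbinom-b-reindex k 1≤k k≤m ⟩
    sum (map (λ j → ((j ∸ 1) C (k ∸ 1)) * b h S (M ∸ j)) (interval k m)) ∎
    where
    open ≡-Reasoning
    nₖ = M + (k ∸ 1)
    M+k≡1+nₖ : M + k ≡ suc nₖ
    M+k≡1+nₖ = trans (cong (M +_) (sym (m+[n∸m]≡n 1≤k))) (+-suc M (k ∸ 1))
    nₖ<M+k : nₖ < M + k
    nₖ<M+k = ≤-reflexive (sym M+k≡1+nₖ)
    m+M∸1≡nₖ+[m∸k] : m + M ∸ 1 ≡ nₖ + (m ∸ k)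
    m+M∸1≡nₖ+[m∸k] = begin
      m + M ∸ 1               ≡⟨ +-∸-comm M 1≤m ⟩
      m ∸ 1 + M               ≡⟨ +-comm (m ∸ 1) M ⟩
      M + (m ∸ 1)             ≡⟨ cong (λ i → M + (i ∸ 1)) (sym (m+[n∸m]≡n k≤m)) ⟩
      M + (k + (m ∸ k) ∸ 1)   ≡⟨ cong (M +_) (+-∸-comm (m ∸ k) 1≤k) ⟩
      M + (k ∸ 1 + (m ∸ k))   ≡⟨ sym (+-assoc M (k ∸ 1) (m ∸ k)) ⟩
      nₖ + (m ∸ k)            ∎
    tₖ+[k∸1]≡M : suc (M ∸ k) + (k ∸ 1) ≡ M
    tₖ+[k∸1]≡M = begin
      suc (M ∸ k) + (k ∸ 1)   ≡⟨ sym (+-suc (M ∸ k) (k ∸ 1)) ⟩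
      M ∸ k + suc (k ∸ 1)     ≡⟨ cong (M ∸ k +_) (m+[n∸m]≡n 1≤k) ⟩
      M ∸ k + k               ≡⟨ m∸n+n≡m (≤-trans k≤m m≤M) ⟩
      M                       ∎

lemma3p7 : (h : ℕ → ℕ) → (∀ i j → 1 ≤ i → i ≤ j → h i ≤ h j) → (∀ i → 1 ≤ i → i < h i)
    → (S : List Pair) → Admissible h S → S ≢ []
    → (a h S 0 ≡ b h S (h (mS S)))
      × (∀ k → 1 ≤ k → k ≤ mS S
         → a h S k ≡ sum (map (λ j → ((j ∸ 1) C (k ∸ 1)) * b h S (h (mS S) ∸ j)) (interval k (mS S))))
lemma3p7 h h-mono h-gt S admissible S≢[] = a₀≡b-M , aₖ-formula
  where open AdmissibleSet h h-mono h-gt S admissible S≢[]
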